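{- Let $\mathcal{I}$ be an ideal and $G$ a $3$-$\mathcal{I}$-generic set. Then $p_G$ dominates every function in $\mathcal{I}$, i.e., for every function $f\in\mathcal{I}$ we have $p_G(x)\ge f(x)$ for all but finitely many $x$.
   Context: Sets are subsets of $\omega$; $p_A$ denotes the principal function of $A$ (its $n$-th element in increasing order). A (Turing) ideal is a (countable) collection of sets closed under $\le_T$ and $\oplus$; a function belongs to $\mathcal{I}$ if (a coding of) its graph does. Each ideal $\mathcal{I}$ is presented by a fixed exact pair $A_0,A_1$ (so $S\in\mathcal{I}$ iff $S\le_T A_0$ and $S\le_T A_1$), and $\Sigma^0_n(\mathcal{I})$ means $\Sigma^0_n(A_0\oplus A_1)$. A Mathias condition is a pair $(D,S)$ with $D$ finite, $S$ infinite, $\max D<\min S$; $(\widetilde D,\widetilde S)$ extends $(D,S)$ if $D\subseteq\widetilde D\subseteq D\cup S$ and $\widetilde S\subseteq S$. A set $X$ satisfies $(D,S)$ if $D\subseteq X\subseteq D\cup S$; $X$ meets a collection $\mathcal{C}$ of conditions if it satisfies a member of $\mathcal{C}$, and avoids $\mathcal{C}$ if it satisfies a condition with no extension in $\mathcal{C}$. An $\mathcal{I}$-condition is a Mathias condition $(D,S)$ with $S\in\mathcal{I}$. A set $G$ is $n$-$\mathcal{I}$-generic if it meets or avoids every $\Sigma^0_n(\mathcal{I})$-definable collection of $\mathcal{I}$-conditions. -}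

module Defs where

open import Data.Nat using (ℕ; zero; suc; _+_; _≤_; _<_; _≡ᵇ_)
open import Data.Nat.DivMod using (_/_; _%_)
open import Data.Bool using (Bool; true; false; if_then_else_; _∨_)
open import Data.Product using (Σ; _×_; _,_; proj₁; proj₂; ∃)
open import Data.Sum using (_⊎_)
open import Level using (Level) renaming (suc to lsuc; zero to lzero)
open import Relation.Nullary using (¬_)
open import Relation.Binary.PropositionalEquality using (_≡_)

SubsetOfω : Set
SubsetOfω = ℕ → Bool

_∈ₛ_ : ℕ → SubsetOfω → Set
n ∈ₛ X = X n ≡ true

Infinite : SubsetOfω → Set
Infinite X = ∀ m → Σ ℕ λ j → m ≤ j × j ∈ₛ X

tri : ℕ → ℕ
tri zero    = zero
tri (suc n) = suc n + tri n

pair : ℕ → ℕ → ℕ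
pair x y = tri (x + y) + y

-- successor in the Cantor enumeration (0,0),(1,0),(0,1),(2,0),(1,1),(0,2),…
nextPair : ℕ × ℕ → ℕ × ℕ
nextPair (suc x , y) = (x , suc y)
nextPair (zero  , y) = (suc y , zero)

unpair : ℕ → ℕ × ℕ
unpair zero    = (zero , zero)
unpair (suc n) = nextPair (unpair n)

fst snd : ℕ → ℕ
fst n = proj₁ (unpair n)
snd n = proj₂ (unpair n)

-- Oracle computation: partial recursive functions ℕ ⇀ ℕ relative to an
-- oracle X (unary presentation via pairing).

data Code : Set where
  zer sucC idC fstC sndC orcC : Code
  compC  : Code → Code → Code   -- compC f g x = f (g x)
  pairC  : Code → Code → Code
  recC   : Code → Code → Code   -- primitive recursion on the 2nd coordinate
  muC    : Code → Code

data Eval (X : SubsetOfω) : Code → ℕ → ℕ → Set where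
  e-zer  : ∀ x → Eval X zer x zero
  e-suc  : ∀ x → Eval X sucC x (suc x)
  e-id   : ∀ x → Eval X idC x x
  e-fst  : ∀ x → Eval X fstC x (fst x)
  e-snd  : ∀ x → Eval X sndC x (snd x)
  e-orc  : ∀ x → Eval X orcC x (if X x then 1 else 0)
  e-comp : ∀ {f g x y z} → Eval X g x y → Eval X f y z → Eval X (compC f g) x z
  e-pair : ∀ {f g x a b} → Eval X f x a → Eval X g x b → Eval X (pairC f g) x (pair a b)
  e-rec0 : ∀ {f g a z} → Eval X f a z → Eval X (recC f g) (pair a zero) z
  e-recS : ∀ {f g a y z w} → Eval X (recC f g) (pair a y) z →
           Eval X g (pair (pair a y) z) w → Eval X (recC f g) (pair a (suc y)) w
  e-mu   : ∀ {f x y} → Eval X f (pair x y) zero →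
           (∀ z → z < y → Σ ℕ λ v → Eval X f (pair x z) (suc v)) →
           Eval X (muC f) x y

-- Gödel numbering of programs: n = ⟨tag, rest⟩, binary nodes rest = ⟨a,b⟩.
-- Decoding with fuel (fuel n suffices for index n, since subcodes are < n).
decodeTag : ℕ → (ℕ → Code) → ℕ → Code
decodeTag 1 d r = zer
decodeTag 2 d r = sucC
decodeTag 3 d r = idC
decodeTag 4 d r = fstC
decodeTag 5 d r = sndC
decodeTag 6 d r = orcC
decodeTag 7 d r = compC (d (fst r)) (d (snd r))
decodeTag 8 d r = pairC (d (fst r)) (d (snd r))
decodeTag 9 d r = recC (d (fst r)) (d (snd r))
decodeTag 10 d r = muC (d r)
decodeTag _ d r = zer

decodeF : ℕ → ℕ → Code
decodeF zero    n = zer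
decodeF (suc k) n = decodeTag (fst n) (decodeF k) (snd n)

decode : ℕ → Code
decode n = decodeF n n

Computes : SubsetOfω → Code → SubsetOfω → Set
Computes X c S = ∀ x → Eval X c x (if S x then 1 else 0)

_≤T_ : SubsetOfω → SubsetOfω → Set
S ≤T X = Σ Code λ c → Computes X c S

_⊕_ : SubsetOfω → SubsetOfω → SubsetOfω
(A ⊕ B) n = if n % 2 ≡ᵇ 0 then A (n / 2) else B (n / 2)

ComputableIn : SubsetOfω → (ℕ → Set) → Set
ComputableIn X P = Σ Code λ c → ∀ x →
  (Eval X c x 0 × ¬ P x) ⊎ (Eval X c x 1 × P x)

Σ⁰ Π⁰ : ℕ → SubsetOfω → (ℕ → Set) → Set₁
Σ⁰ zero    X P = Level.Lift _ (ComputableIn X P)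
Σ⁰ (suc n) X P = Σ (ℕ → Set) λ Q → Π⁰ n X Q ×
  (∀ x → (P x → Σ ℕ λ y → Q (pair x y)) × ((Σ ℕ λ y → Q (pair x y)) → P x))
Π⁰ zero    X P = Level.Lift _ (ComputableIn X P)
Π⁰ (suc n) X P = Σ (ℕ → Set) λ Q → Σ⁰ n X Q ×
  (∀ x → (P x → ∀ y → Q (pair x y)) × ((∀ y → Q (pair x y)) → P x))

-- Ideals presented by an exact pair A₀, A₁

Ideal : SubsetOfω → SubsetOfω → SubsetOfω → Set
Ideal A₀ A₁ S = (S ≤T A₀) × (S ≤T A₁)

-- the pair presents an ideal: the class is closed under ⊕
-- (closure under ≤T is automatic)
IsIdealPair : SubsetOfω → SubsetOfω → Set
IsIdealPair A₀ A₁ = ∀ S T → Ideal A₀ A₁ S → Ideal A₀ A₁ T → Ideal A₀ A₁ (S ⊕ T)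

select : SubsetOfω → SubsetOfω → ℕ → SubsetOfω
select A₀ A₁ zero    = A₀
select A₀ A₁ (suc _) = A₁

-- functions: graph {⟨x,y⟩ : f x = y}
anyBelow : ℕ → (ℕ → Bool) → Bool
anyBelow zero    p = false
anyBelow (suc m) p = p m ∨ anyBelow m p

graph : (ℕ → ℕ) → SubsetOfω
graph f n = anyBelow (suc n) (λ x → pair x (f x) ≡ᵇ n)

FunIn : SubsetOfω → SubsetOfω → (ℕ → ℕ) → Set
FunIn A₀ A₁ f = Ideal A₀ A₁ (graph f)

-- Finite sets D via canonical index: k ∈ D  iff  bit k of d is 1

bit : ℕ → ℕ → Bool
bit d zero    = d % 2 ≡ᵇ 1
bit d (suc k) = bit (d / 2) k

-- Mathias condition (D,S), D given by canonical index d
MathiasCondition : ℕ → SubsetOfω → Set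
MathiasCondition d S = Infinite S × (∀ k j → k ∈ₛ bit d → j ∈ₛ S → k < j)

ICondition : SubsetOfω → SubsetOfω → ℕ → SubsetOfω → Set
ICondition A₀ A₁ d S = MathiasCondition d S × Ideal A₀ A₁ S

Extends : ℕ → SubsetOfω → ℕ → SubsetOfω → Set
Extends d' S' d S =
  (∀ k → k ∈ₛ bit d → k ∈ₛ bit d') ×
  (∀ k → k ∈ₛ bit d' → k ∈ₛ bit d ⊎ k ∈ₛ S) ×
  (∀ k → k ∈ₛ S' → k ∈ₛ S)

Satisfies : SubsetOfω → ℕ → SubsetOfω → Set
Satisfies X d S = (∀ k → k ∈ₛ bit d → k ∈ₛ X) × (∀ k → k ∈ₛ X → k ∈ₛ bit d ⊎ k ∈ₛ S)

Collection : Set₁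
Collection = ℕ → SubsetOfω → Set

-- C is a Σ⁰ₙ(ℐ)-definable collection of ℐ-conditions: all members are
-- ℐ-conditions, and there is a Σ⁰ₙ(A₀ ⊕ A₁) set W of codes ⟨d,⟨i,e⟩⟩ such
-- that (d , S) ∈ C iff some code ⟨d,⟨i,e⟩⟩ ∈ W has S = Φ_e^{A_i}.
Σ-ICollection : ℕ → SubsetOfω → SubsetOfω → Collection → Set₁
Σ-ICollection n A₀ A₁ C =
  (∀ d S → C d S → ICondition A₀ A₁ d S) ×
  (Σ (ℕ → Set) λ W → Σ⁰ n (A₀ ⊕ A₁) W ×
     (∀ d S → (C d S → Σ ℕ λ i → Σ ℕ λ e →
                 W (pair d (pair i e)) × Computes (select A₀ A₁ i) (decode e) S)
            × ((Σ ℕ λ i → Σ ℕ λ e →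
                 W (pair d (pair i e)) × Computes (select A₀ A₁ i) (decode e) S) → C d S)))

Meets : SubsetOfω → Collection → Set
Meets G C = Σ ℕ λ d → Σ SubsetOfω λ S → C d S × Satisfies G d S

Avoids : SubsetOfω → SubsetOfω → SubsetOfω → Collection → Set
Avoids A₀ A₁ G C = Σ ℕ λ d → Σ SubsetOfω λ S →
  ICondition A₀ A₁ d S × Satisfies G d S ×
  (∀ d' S' → Extends d' S' d S → ¬ C d' S')

Generic : ℕ → SubsetOfω → SubsetOfω → SubsetOfω → Set₁
Generic n A₀ A₁ G = ∀ C → Σ-ICollection n A₀ A₁ C → Meets G C ⊎ Avoids A₀ A₁ G C

-- principal function: p_G(x) = m  iff  m ∈ G and |G ∩ [0,m)| = x

countBelow : SubsetOfω → ℕ → ℕ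
countBelow G zero    = zero
countBelow G (suc m) = (if G m then 1 else 0) + countBelow G m

PrincipalAt : SubsetOfω → ℕ → ℕ → Set
PrincipalAt G x m = m ∈ₛ G × countBelow G m ≡ x

-- Call S sparse above d for f when every y ∈ S has y ≥ d and f x ≤ y for all x ≤ d, and whenever
-- y′ < y both lie in S, f x ≤ y for all x ≤ y′ + 1. If G satisfies a Mathias condition (D , S) with S
-- sparse above d > max D and x ≥ d, then m = p_G(x) lies in S: if G has no element in [d , m) then
-- x ≤ d, and otherwise the last one, y′, lies in S and x ≤ y′ + 1; either way f x ≤ m.
--
-- So it suffices that G meets the collection of ℐ-conditions (d , S) with S sparse above d. It is
-- Σ⁰₃(ℐ): it asks for indices e, e′ with S = Φ_e^{A_i} = Φ_{e′}^{A_{1-i}} total (∀∃), S infinite (∀∃),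
-- and no violation of sparseness (∀, a violation being witnessed by finitely many halting
-- computations). Halting computations are expressed arithmetically by certificates: finite traces
-- each entry of which is justified by earlier ones. No ℐ-condition (d , S) avoids the collection,
-- since thinning S greedily to the elements that keep it sparse gives an extension (d , S′) with
-- S′ ≤_T S ⊕ graph f in ℐ.

module Submission where

open import Defs
open import Data.Nat
open import Data.Nat.Properties
open import Data.Nat.DivMod using (_/_; _%_; m/n<m; m*n%n≡0; m*n/n≡m; [m+kn]%n≡m%n; +-distrib-/)
open import Data.Fin using (Fin; zero; suc; #_; inject₁)
open import Data.List using (List; []; _∷_; _++_; length; [_])
open import Data.List.Properties using (length-++)
open import Data.Bool using (Bool; true; false; if_then_else_; _∨_; not; T)
open import Data.Product using (Σ; _×_; _,_; proj₁; proj₂)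
open import Data.Sum using (_⊎_; inj₁; inj₂; [_,_]′)
open import Data.Empty using (⊥; ⊥-elim)
open import Data.Unit using (tt)
open import Relation.Nullary using (¬_; yes; no; contradiction)
open import Relation.Binary.PropositionalEquality hiding ([_])
open import Relation.Binary.Definitions using (tri<; tri≈; tri>)
import Level

-- Cantor pairing and tuples

pair-sucʳ : ∀ x y → pair x (suc y) ≡ suc (pair (suc x) y)
pair-sucʳ x y = begin
    tri (x + suc y) + suc y  ≡⟨ cong (λ k → tri k + suc y) (+-suc x y) ⟩
    tri (suc (x + y)) + suc y ≡⟨ +-suc (tri (suc (x + y))) y ⟩
    suc (tri (suc (x + y)) + y) ∎
  where open ≡-Reasoning

pair-zero : ∀ y → pair (suc y) zero ≡ suc (pair zero y)
pair-zero y = begin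
    tri (suc y + 0) + 0 ≡⟨ +-identityʳ _ ⟩
    tri (suc y + 0) ≡⟨ cong (λ k → tri (suc k)) (+-identityʳ y) ⟩
    suc (y + tri y) ≡⟨ cong suc (+-comm y (tri y)) ⟩
    suc (tri y + y) ∎
  where open ≡-Reasoning

unpair-pair-diagonal : ∀ s y x → x + y ≡ s → unpair (pair x y) ≡ (x , y)
unpair-pair-diagonal s zero zero eq = refl
unpair-pair-diagonal zero zero (suc x) ()
unpair-pair-diagonal (suc s) zero (suc x) eq =
  trans (cong unpair (pair-zero x))
    (cong nextPair (unpair-pair-diagonal s x zero (trans (sym (+-identityʳ x)) (suc-injective eq))))
unpair-pair-diagonal s (suc y) x eq =
  trans (cong unpair (pair-sucʳ x y))
    (cong nextPair (unpair-pair-diagonal s y (suc x) (trans (sym (+-suc x y)) eq)))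

unpair-pair : ∀ x y → unpair (pair x y) ≡ (x , y)
unpair-pair x y = unpair-pair-diagonal (x + y) y x refl

fst-pair : ∀ x y → fst (pair x y) ≡ x
fst-pair x y = cong proj₁ (unpair-pair x y)

snd-pair : ∀ x y → snd (pair x y) ≡ y
snd-pair x y = cong proj₂ (unpair-pair x y)

pair-unpair : ∀ n → pair (fst n) (snd n) ≡ n
pair-unpair zero = refl
pair-unpair (suc n) with unpair n | pair-unpair n
... | (suc x , y) | eq = trans (pair-sucʳ x y) (cong suc eq)
... | (zero , y) | eq = trans (pair-zero y) (cong suc eq)

pair-inj₁ : ∀ {a b c d} → pair a b ≡ pair c d → a ≡ c
pair-inj₁ {a} {b} {c} {d} eq = trans (sym (fst-pair a b)) (trans (cong fst eq) (fst-pair c d))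

pair-inj₂ : ∀ {a b c d} → pair a b ≡ pair c d → b ≡ d
pair-inj₂ {a} {b} {c} {d} eq = trans (sym (snd-pair a b)) (trans (cong snd eq) (snd-pair c d))

tri-≥ : ∀ n → n ≤ tri n
tri-≥ zero = z≤n
tri-≥ (suc n) = m≤m+n (suc n) (tri n)

pair-≥₂ : ∀ x y → y ≤ pair x y
pair-≥₂ x y = m≤n+m y (tri (x + y))

pair-≥₁ : ∀ x y → x ≤ pair x y
pair-≥₁ x y = ≤-trans (≤-trans (m≤m+n x y) (tri-≥ (x + y))) (m≤m+n (tri (x + y)) y)

pair->₂ : ∀ x y → 1 ≤ x → y < pair x y
pair->₂ (suc x) y _ = begin-strict
    y <⟨ n<1+n y ⟩
    suc y ≤⟨ +-monoʳ-≤ 1 (m≤n+m y x) ⟩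
    suc (x + y) ≤⟨ tri-≥ (suc (x + y)) ⟩
    tri (suc x + y) ≤⟨ m≤m+n _ y ⟩
    pair (suc x) y ∎
  where open ≤-Reasoning

fst-≤ : ∀ n → fst n ≤ n
fst-≤ n = subst (fst n ≤_) (pair-unpair n) (pair-≥₁ (fst n) (snd n))

snd-≤ : ∀ n → snd n ≤ n
snd-≤ n = subst (snd n ≤_) (pair-unpair n) (pair-≥₂ (fst n) (snd n))

tuple₃ : ℕ × ℕ × ℕ → ℕ
tuple₃ (a , b , c) = pair a (pair b c)

tuple₄ : ℕ × ℕ × ℕ × ℕ → ℕ
tuple₄ (a , t) = pair a (tuple₃ t)

tuple₅ : ℕ × ℕ × ℕ × ℕ × ℕ → ℕ
tuple₅ (a , t) = pair a (tuple₄ t)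

untuple₃ : ℕ → ℕ × ℕ × ℕ
untuple₃ n = fst n , unpair (snd n)

untuple₄ : ℕ → ℕ × ℕ × ℕ × ℕ
untuple₄ n = fst n , untuple₃ (snd n)

untuple₅ : ℕ → ℕ × ℕ × ℕ × ℕ × ℕ
untuple₅ n = fst n , untuple₄ (snd n)

untuple₃-tuple₃ : ∀ t → untuple₃ (tuple₃ t) ≡ t
untuple₃-tuple₃ (a , b , c) =
  cong₂ _,_ (fst-pair a (pair b c)) (trans (cong unpair (snd-pair a (pair b c))) (unpair-pair b c))

untuple₄-tuple₄ : ∀ t → untuple₄ (tuple₄ t) ≡ t
untuple₄-tuple₄ (a , t) =
  cong₂ _,_ (fst-pair a (tuple₃ t)) (trans (cong untuple₃ (snd-pair a (tuple₃ t))) (untuple₃-tuple₃ t))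

untuple₅-tuple₅ : ∀ t → untuple₅ (tuple₅ t) ≡ t
untuple₅-tuple₅ (a , t) =
  cong₂ _,_ (fst-pair a (tuple₄ t)) (trans (cong untuple₄ (snd-pair a (tuple₄ t))) (untuple₄-tuple₄ t))

-- Oracle computations

module _ {X : SubsetOfω} where
  Eval-deterministic : ∀ {c x x' v w} → Eval X c x v → Eval X c x' w → x ≡ x' → v ≡ w
  Eval-deterministic (e-zer x) (e-zer _) eq = refl
  Eval-deterministic (e-suc x) (e-suc _) eq = cong suc eq
  Eval-deterministic (e-id x) (e-id _) eq = eq
  Eval-deterministic (e-fst x) (e-fst _) eq = cong fst eq
  Eval-deterministic (e-snd x) (e-snd _) eq = cong snd eq
  Eval-deterministic (e-orc x) (e-orc _) eq = cong (λ z → if X z then 1 else 0) eq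
  Eval-deterministic (e-comp d1 d2) (e-comp d1' d2') eq = Eval-deterministic d2 d2' (Eval-deterministic d1 d1' eq)
  Eval-deterministic (e-pair d1 d2) (e-pair d1' d2') eq = cong₂ pair (Eval-deterministic d1 d1' eq) (Eval-deterministic d2 d2' eq)
  Eval-deterministic (e-rec0 {a = a} d) (e-rec0 {a = a'} d') eq = Eval-deterministic d d' (pair-inj₁ {a} {0} {a'} {0} eq)
  Eval-deterministic (e-rec0 {a = a} _) (e-recS {a = a'} {y = y} _ _) eq with pair-inj₂ {a} {0} {a'} {suc y} eq
  ... | ()
  Eval-deterministic (e-recS {a = a} {y = y} _ _) (e-rec0 {a = a'} _) eq with pair-inj₂ {a} {suc y} {a'} {0} eq
  ... | ()
  Eval-deterministic (e-recS {a = a} {y = y} d1 d2) (e-recS {a = a'} {y = y'} d1' d2') eq =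
    let a≡ = pair-inj₁ {a} {suc y} {a'} {suc y'} eq
        y≡ = suc-injective (pair-inj₂ {a} {suc y} {a'} {suc y'} eq)
        z≡ = Eval-deterministic d1 d1' (cong₂ pair a≡ y≡)
    in Eval-deterministic d2 d2' (cong₂ pair (cong₂ pair a≡ y≡) z≡)
  Eval-deterministic (e-mu {y = y} d h) (e-mu {y = y'} d' h') eq with <-cmp y y'
  ... | tri≈ _ y≡ _ = y≡
  ... | tri< lt _ _ with h' y lt
  ...   | (v , dv) with Eval-deterministic d dv (cong (λ x → pair x y) eq)
  ...     | ()
  Eval-deterministic (e-mu {y = y} d h) (e-mu {y = y'} d' h') eq | tri> _ _ gt with h y' gt
  ...   | (v , dv) with Eval-deterministic dv d' (cong (λ x → pair x y') eq)
  ...     | ()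

  Eval-functional : ∀ {c x v w} → Eval X c x v → Eval X c x w → v ≡ w
  Eval-functional d d' = Eval-deterministic d d' refl

plugOracle : Code → Code → Code
plugOracle c zer = zer
plugOracle c sucC = sucC
plugOracle c idC = idC
plugOracle c fstC = fstC
plugOracle c sndC = sndC
plugOracle c orcC = c
plugOracle c (compC p q) = compC (plugOracle c p) (plugOracle c q)
plugOracle c (pairC p q) = pairC (plugOracle c p) (plugOracle c q)
plugOracle c (recC p q) = recC (plugOracle c p) (plugOracle c q)
plugOracle c (muC p) = muC (plugOracle c p)

plugOracle-correct : ∀ {X Y c} → Computes X c Y → ∀ {p x v} → Eval Y p x v → Eval X (plugOracle c p) x v
plugOracle-correct hc (e-zer x) = e-zer x
plugOracle-correct hc (e-suc x) = e-suc x
plugOracle-correct hc (e-id x) = e-id x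
plugOracle-correct hc (e-fst x) = e-fst x
plugOracle-correct hc (e-snd x) = e-snd x
plugOracle-correct hc (e-orc x) = hc x
plugOracle-correct hc (e-comp d d₁) = e-comp (plugOracle-correct hc d) (plugOracle-correct hc d₁)
plugOracle-correct hc (e-pair d d₁) = e-pair (plugOracle-correct hc d) (plugOracle-correct hc d₁)
plugOracle-correct hc (e-rec0 {a = a} d) = e-rec0 {a = a} (plugOracle-correct hc d)
plugOracle-correct hc (e-recS {a = a} {y = y} d d₁) = e-recS {a = a} {y = y} (plugOracle-correct hc d) (plugOracle-correct hc d₁)
plugOracle-correct hc (e-mu d h) = e-mu (plugOracle-correct hc d) (λ z lt → proj₁ (h z lt) , plugOracle-correct hc (proj₂ (h z lt)))

encode : Code → ℕ
encode zer = pair 1 0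
encode sucC = pair 2 0
encode idC = pair 3 0
encode fstC = pair 4 0
encode sndC = pair 5 0
encode orcC = pair 6 0
encode (compC a b) = pair 7 (pair (encode a) (encode b))
encode (pairC a b) = pair 8 (pair (encode a) (encode b))
encode (recC a b) = pair 9 (pair (encode a) (encode b))
encode (muC a) = pair 10 (encode a)

decodeTag-cong : ∀ t {d d' : ℕ → Code} r → d (fst r) ≡ d' (fst r) → d (snd r) ≡ d' (snd r) → d r ≡ d' r →
          decodeTag t d r ≡ decodeTag t d' r
decodeTag-cong 0 r e1 e2 e3 = refl
decodeTag-cong 1 r e1 e2 e3 = refl
decodeTag-cong 2 r e1 e2 e3 = refl
decodeTag-cong 3 r e1 e2 e3 = refl
decodeTag-cong 4 r e1 e2 e3 = refl
decodeTag-cong 5 r e1 e2 e3 = refl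
decodeTag-cong 6 r e1 e2 e3 = refl
decodeTag-cong 7 r e1 e2 e3 = cong₂ compC e1 e2
decodeTag-cong 8 r e1 e2 e3 = cong₂ pairC e1 e2
decodeTag-cong 9 r e1 e2 e3 = cong₂ recC e1 e2
decodeTag-cong 10 r e1 e2 e3 = cong muC e3
decodeTag-cong (suc (suc (suc (suc (suc (suc (suc (suc (suc (suc (suc t))))))))))) r e1 e2 e3 = refl

snd-suc-< : ∀ n → snd (suc n) < suc n
snd-suc-< n with unpair n | pair-unpair n
... | (suc x , y) | eq = s≤s (subst (suc y ≤_) eq (pair->₂ (suc x) y (s≤s z≤n)))
... | (zero , y) | eq = s≤s z≤n

decodeF-fuel : ∀ k n m → m ≤ k → m ≤ n → decodeF k m ≡ decodeF n m
decodeF-fuel zero zero zero _ _ = refl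
decodeF-fuel zero (suc n) zero _ _ = refl
decodeF-fuel (suc k) zero zero _ _ = refl
decodeF-fuel (suc k) (suc n) zero _ _ = refl
decodeF-fuel (suc k) (suc n) (suc m) (s≤s mk) (s≤s mn) =
  decodeTag-cong (fst (suc m)) (snd (suc m))
    (decodeF-fuel k n _ (≤-trans (fst-≤ r) rk) (≤-trans (fst-≤ r) rn))
    (decodeF-fuel k n _ (≤-trans (snd-≤ r) rk) (≤-trans (snd-≤ r) rn))
    (decodeF-fuel k n _ rk rn)
  where
  r = snd (suc m)
  rm : r ≤ m
  rm = ≤-pred (snd-suc-< m)
  rk = ≤-trans rm mk
  rn = ≤-trans rm mn

decode-unfold : ∀ c → decode c ≡ decodeTag (fst c) decode (snd c)
decode-unfold zero = refl
decode-unfold (suc k) =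
  decodeTag-cong (fst (suc k)) (snd (suc k))
    (decodeF-fuel k _ _ (≤-trans (fst-≤ r) rk) ≤-refl)
    (decodeF-fuel k _ _ (≤-trans (snd-≤ r) rk) ≤-refl)
    (decodeF-fuel k _ _ rk ≤-refl)
  where
  r = snd (suc k)
  rk : r ≤ k
  rk = ≤-pred (snd-suc-< k)

decode-encode : ∀ c → decode (encode c) ≡ c
decode-encode zer = trans (decode-unfold (pair 1 0)) (cong (λ t → decodeTag t decode (snd (pair 1 0))) (fst-pair 1 0))
decode-encode sucC = trans (decode-unfold (pair 2 0)) (cong (λ t → decodeTag t decode (snd (pair 2 0))) (fst-pair 2 0))
decode-encode idC = trans (decode-unfold (pair 3 0)) (cong (λ t → decodeTag t decode (snd (pair 3 0))) (fst-pair 3 0))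
decode-encode fstC = trans (decode-unfold (pair 4 0)) (cong (λ t → decodeTag t decode (snd (pair 4 0))) (fst-pair 4 0))
decode-encode sndC = trans (decode-unfold (pair 5 0)) (cong (λ t → decodeTag t decode (snd (pair 5 0))) (fst-pair 5 0))
decode-encode orcC = trans (decode-unfold (pair 6 0)) (cong (λ t → decodeTag t decode (snd (pair 6 0))) (fst-pair 6 0))
decode-encode (compC a b) rewrite decode-unfold (pair 7 (pair (encode a) (encode b))) | fst-pair 7 (pair (encode a) (encode b))
  | snd-pair 7 (pair (encode a) (encode b)) | fst-pair (encode a) (encode b) | snd-pair (encode a) (encode b)
  | decode-encode a | decode-encode b = refl
decode-encode (pairC a b) rewrite decode-unfold (pair 8 (pair (encode a) (encode b))) | fst-pair 8 (pair (encode a) (encode b))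
  | snd-pair 8 (pair (encode a) (encode b)) | fst-pair (encode a) (encode b) | snd-pair (encode a) (encode b)
  | decode-encode a | decode-encode b = refl
decode-encode (recC a b) rewrite decode-unfold (pair 9 (pair (encode a) (encode b))) | fst-pair 9 (pair (encode a) (encode b))
  | snd-pair 9 (pair (encode a) (encode b)) | fst-pair (encode a) (encode b) | snd-pair (encode a) (encode b)
  | decode-encode a | decode-encode b = refl
decode-encode (muC a) rewrite decode-unfold (pair 10 (encode a)) | fst-pair 10 (encode a)
  | snd-pair 10 (encode a) | decode-encode a = refl

≡ᵇ-true : ∀ m n → (m ≡ᵇ n) ≡ true → m ≡ n
≡ᵇ-true m n eq = ≡ᵇ⇒≡ m n (subst T (sym eq) tt)

≡ᵇ-refl : ∀ m → (m ≡ᵇ m) ≡ true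
≡ᵇ-refl zero = refl
≡ᵇ-refl (suc m) = ≡ᵇ-refl m

∨-introˡ : ∀ a b → a ≡ true → (a ∨ b) ≡ true
∨-introˡ true b _ = refl

∨-introʳ : ∀ a b → b ≡ true → (a ∨ b) ≡ true
∨-introʳ true b _ = refl
∨-introʳ false b e = e

anyBelow-intro : ∀ m (p : ℕ → Bool) x → x < m → p x ≡ true → anyBelow m p ≡ true
anyBelow-intro (suc m) p x x<m px with x ≟ m
... | yes refl = ∨-introˡ (p x) _ px
... | no ne = ∨-introʳ (p m) _ (anyBelow-intro m p x (≤∧≢⇒< (≤-pred x<m) ne) px)

anyBelow-elim : ∀ m (p : ℕ → Bool) → anyBelow m p ≡ true → Σ ℕ λ x → x < m × p x ≡ true
anyBelow-elim zero p ()
anyBelow-elim (suc m) p eq with p m in pm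
... | true = m , ≤-refl , pm
... | false with anyBelow-elim m p eq
...   | (x , lt , px) = x , m<n⇒m<1+n lt , px

graph-complete : ∀ f x → graph f (pair x (f x)) ≡ true
graph-complete f x = anyBelow-intro (suc (pair x (f x))) _ x (s≤s (pair-≥₁ x (f x))) (≡ᵇ-refl (pair x (f x)))

graph-sound : ∀ f x w → graph f (pair x w) ≡ true → f x ≡ w
graph-sound f x w eq with anyBelow-elim (suc (pair x w)) (λ z → pair z (f z) ≡ᵇ pair x w) eq
... | (z , _ , pz) =
  let e = ≡ᵇ-true _ _ pz
      z≡x = pair-inj₁ {z} {f z} {x} {w} e
  in trans (cong f (sym z≡x)) (pair-inj₂ {z} {f z} {x} {w} e)

-- Primitive recursive expressions and their compilation

data Exp : ℕ → Set where
  var : ∀ {n} → Fin n → Exp n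
  lit : ∀ {n} → ℕ → Exp n
  sucE fstE sndE orcE appF : ∀ {n} → Exp n → Exp n
  pairE : ∀ {n} → Exp n → Exp n → Exp n
  recE : ∀ {n} → Exp n → Exp (suc (suc n)) → Exp n → Exp n

Env : ℕ → Set
Env n = Fin n → ℕ

infixr 5 _∷ᵉ_
_∷ᵉ_ : ∀ {n} → ℕ → Env n → Env (suc n)
(a ∷ᵉ ρ) zero = a
(a ∷ᵉ ρ) (suc i) = ρ i

ρ∅ : Env 0
ρ∅ ()

encE : ∀ n → Env n → ℕ
encE zero ρ = 0
encE (suc n) ρ = pair (ρ zero) (encE n (λ i → ρ (suc i)))

iterN : ℕ → (ℕ → ℕ → ℕ) → ℕ → ℕ
iterN b s zero = b
iterN b s (suc y) = s y (iterN b s y)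

module Semantics (X : SubsetOfω) (f : ℕ → ℕ) where
  ⟦_⟧ : ∀ {n} → Exp n → Env n → ℕ
  ⟦ var i ⟧ ρ = ρ i
  ⟦ lit k ⟧ ρ = k
  ⟦ sucE e ⟧ ρ = suc (⟦ e ⟧ ρ)
  ⟦ fstE e ⟧ ρ = fst (⟦ e ⟧ ρ)
  ⟦ sndE e ⟧ ρ = snd (⟦ e ⟧ ρ)
  ⟦ orcE e ⟧ ρ = if X (⟦ e ⟧ ρ) then 1 else 0
  ⟦ appF e ⟧ ρ = f (⟦ e ⟧ ρ)
  ⟦ pairE a b ⟧ ρ = pair (⟦ a ⟧ ρ) (⟦ b ⟧ ρ)
  ⟦ recE b s k ⟧ ρ = iterN (⟦ b ⟧ ρ) (λ y r → ⟦ s ⟧ (y ∷ᵉ r ∷ᵉ ρ)) (⟦ k ⟧ ρ)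

literalCode : ℕ → Code
literalCode zero = zer
literalCode (suc k) = compC sucC (literalCode k)

recEnvCode : Code
recEnvCode = pairC (compC sndC fstC) (pairC sndC (compC fstC fstC))

compile : Code → ∀ {n} → Exp n → Code
compile cf (var zero) = fstC
compile cf (var (suc i)) = compC (compile cf (var i)) sndC
compile cf (lit k) = literalCode k
compile cf (sucE e) = compC sucC (compile cf e)
compile cf (fstE e) = compC fstC (compile cf e)
compile cf (sndE e) = compC sndC (compile cf e)
compile cf (orcE e) = compC orcC (compile cf e)
compile cf (appF e) = compC cf (compile cf e)
compile cf (pairE a b) = pairC (compile cf a) (compile cf b)
compile cf (recE b s k) = compC (recC (compile cf b) (compC (compile cf s) recEnvCode)) (pairC idC (compile cf k))

module _ {X : SubsetOfω} where
  eval-fst-pair : ∀ a b → Eval X fstC (pair a b) a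
  eval-fst-pair a b = subst (Eval X fstC (pair a b)) (fst-pair a b) (e-fst _)

  eval-snd-pair : ∀ a b → Eval X sndC (pair a b) b
  eval-snd-pair a b = subst (Eval X sndC (pair a b)) (snd-pair a b) (e-snd _)

  eval-literal : ∀ k x → Eval X (literalCode k) x k
  eval-literal zero x = e-zer x
  eval-literal (suc k) x = e-comp (eval-literal k x) (e-suc k)

  eval-recEnv : ∀ a y r → Eval X recEnvCode (pair (pair a y) r) (pair y (pair r a))
  eval-recEnv a y r = e-pair (e-comp (eval-fst-pair (pair a y) r) (eval-snd-pair a y))
                       (e-pair (eval-snd-pair (pair a y) r) (e-comp (eval-fst-pair (pair a y) r) (eval-fst-pair a y)))

  eval-recC : ∀ {cb cs a b} {s : ℕ → ℕ → ℕ} → Eval X cb a b →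
         (∀ y r → Eval X cs (pair (pair a y) r) (s y r)) →
         ∀ y → Eval X (recC cb cs) (pair a y) (iterN b s y)
  eval-recC {a = a} hb hs zero = e-rec0 {a = a} hb
  eval-recC {a = a} hb hs (suc y) = e-recS {a = a} {y = y} (eval-recC hb hs y) (hs y _)

module CompileCorrect (X : SubsetOfω) (f : ℕ → ℕ) (cf : Code) (hcf : ∀ m → Eval X cf m (f m)) where
  open Semantics X f

  compile-correct : ∀ {n} (e : Exp n) (ρ : Env n) → Eval X (compile cf e) (encE n ρ) (⟦ e ⟧ ρ)
  compile-correct (var zero) ρ = eval-fst-pair _ _
  compile-correct {suc n} (var (suc i)) ρ = e-comp (eval-snd-pair (ρ zero) (encE n (λ j → ρ (suc j)))) (compile-correct (var i) (λ j → ρ (suc j)))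
  compile-correct (lit k) ρ = eval-literal k _
  compile-correct (sucE e) ρ = e-comp (compile-correct e ρ) (e-suc _)
  compile-correct (fstE e) ρ = e-comp (compile-correct e ρ) (e-fst _)
  compile-correct (sndE e) ρ = e-comp (compile-correct e ρ) (e-snd _)
  compile-correct (orcE e) ρ = e-comp (compile-correct e ρ) (e-orc _)
  compile-correct (appF e) ρ = e-comp (compile-correct e ρ) (hcf _)
  compile-correct (pairE a b) ρ = e-pair (compile-correct a ρ) (compile-correct b ρ)
  compile-correct {n} (recE b s k) ρ =
    e-comp (e-pair (e-id _) (compile-correct k ρ))
           (eval-recC (compile-correct b ρ) (λ y r → e-comp (eval-recEnv (encE n ρ) y r) (compile-correct s (y ∷ᵉ r ∷ᵉ ρ))) (⟦ k ⟧ ρ))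

-- compile works on encoded environments; compile₁ runs it on the environment ⟨m , 0⟩ of one variable.
compile₁ : Code → Exp 1 → Code
compile₁ cf e = compC (compile cf e) (pairC idC zer)

module Compile₁ (X : SubsetOfω) (f : ℕ → ℕ) (cf : Code) (hcf : ∀ m → Eval X cf m (f m)) where
  open Semantics X f
  open CompileCorrect X f cf hcf
  compile₁-correct : ∀ (e : Exp 1) m → Eval X (compile₁ cf e) m (⟦ e ⟧ (m ∷ᵉ ρ∅))
  compile₁-correct e m = e-comp (e-pair (e-id m) (e-zer m)) (compile-correct e (m ∷ᵉ ρ∅))

-- Expressions as arithmetical formulas

-- A plain pair of maps: with the setoid-based _⇔_ of Function.Bundles, checking the large
-- formulas below becomes impractically slow.
infix 2 _⇔_
_⇔_ : Set → Set → Set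
A ⇔ B = (A → B) × (B → A)

Truthy : ℕ → Set
Truthy v = 1 ≤ v

zero-not-Truthy : ∀ {v} → v ≡ 0 → Truthy v → ⊥
zero-not-Truthy refl ()

Truthy-or-zero : ∀ v → Truthy v ⊎ v ≡ 0
Truthy-or-zero zero = inj₂ refl
Truthy-or-zero (suc v) = inj₁ (s≤s z≤n)

lift2 : ∀ {n m} → (Fin n → Fin m) → Fin (suc (suc n)) → Fin (suc (suc m))
lift2 r zero = zero
lift2 r (suc zero) = suc zero
lift2 r (suc (suc i)) = suc (suc (r i))

ren : ∀ {n m} → (Fin n → Fin m) → Exp n → Exp m
ren r (var i) = var (r i)
ren r (lit k) = lit k
ren r (sucE e) = sucE (ren r e)
ren r (fstE e) = fstE (ren r e)
ren r (sndE e) = sndE (ren r e)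
ren r (orcE e) = orcE (ren r e)
ren r (appF e) = appF (ren r e)
ren r (pairE a b) = pairE (ren r a) (ren r b)
ren r (recE b s k) = recE (ren r b) (ren (lift2 r) s) (ren r k)

iterN-cong : ∀ b {s s' : ℕ → ℕ → ℕ} → (∀ y r → s y r ≡ s' y r) → ∀ k → iterN b s k ≡ iterN b s' k
iterN-cong b h zero = refl
iterN-cong b {s} {s'} h (suc k) = trans (cong (s k) (iterN-cong b h k)) (h k _)

wk : ∀ {n} → Exp n → Exp (suc n)
wk = ren suc

skip1 : ∀ {n} → Fin (suc n) → Fin (suc (suc n))
skip1 zero = zero
skip1 (suc i) = suc (suc i)

module RenamingSemantics (X : SubsetOfω) (f : ℕ → ℕ) where
  open Semantics X f

  ren-sem : ∀ {n m} (r : Fin n → Fin m) (e : Exp n) (ρ : Env m) (σ : Env n) →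
            (∀ i → ρ (r i) ≡ σ i) → ⟦ ren r e ⟧ ρ ≡ ⟦ e ⟧ σ
  ren-sem r (var i) ρ σ h = h i
  ren-sem r (lit k) ρ σ h = refl
  ren-sem r (sucE e) ρ σ h = cong suc (ren-sem r e ρ σ h)
  ren-sem r (fstE e) ρ σ h = cong fst (ren-sem r e ρ σ h)
  ren-sem r (sndE e) ρ σ h = cong snd (ren-sem r e ρ σ h)
  ren-sem r (orcE e) ρ σ h = cong (λ z → if X z then 1 else 0) (ren-sem r e ρ σ h)
  ren-sem r (appF e) ρ σ h = cong f (ren-sem r e ρ σ h)
  ren-sem r (pairE a b) ρ σ h = cong₂ pair (ren-sem r a ρ σ h) (ren-sem r b ρ σ h)
  ren-sem r (recE b s k) ρ σ h =
    trans (cong₂ (λ B K → iterN B (λ y r' → ⟦ ren (lift2 r) s ⟧ (y ∷ᵉ r' ∷ᵉ ρ)) K)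
                 (ren-sem r b ρ σ h) (ren-sem r k ρ σ h))
          (iterN-cong (⟦ b ⟧ σ) (λ y r' → ren-sem (lift2 r) s (y ∷ᵉ r' ∷ᵉ ρ) (y ∷ᵉ r' ∷ᵉ σ) (agree y r')) (⟦ k ⟧ σ))
    where
    agree : ∀ y r' i → (y ∷ᵉ r' ∷ᵉ ρ) (lift2 r i) ≡ (y ∷ᵉ r' ∷ᵉ σ) i
    agree y r' zero = refl
    agree y r' (suc zero) = refl
    agree y r' (suc (suc i)) = h i

  wk-sem : ∀ {n} (e : Exp n) a (ρ : Env n) → ⟦ wk e ⟧ (a ∷ᵉ ρ) ≡ ⟦ e ⟧ ρ
  wk-sem e a ρ = ren-sem suc e (a ∷ᵉ ρ) ρ (λ i → refl)

isz : ∀ {n} → Exp n → Exp n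
isz e = recE (lit 1) (lit 0) e

orE : ∀ {n} → Exp n → Exp n → Exp n
orE a b = recE a (lit 1) b

andE : ∀ {n} → Exp n → Exp n → Exp n
andE a b = isz (orE (isz a) (isz b))

predE : ∀ {n} → Exp n → Exp n
predE e = recE (lit 0) (var zero) e

monusE : ∀ {n} → Exp n → Exp n → Exp n
monusE a b = recE a (predE (var (suc zero))) b

leE : ∀ {n} → Exp n → Exp n → Exp n
leE a b = isz (monusE a b)

ltE : ∀ {n} → Exp n → Exp n → Exp n
ltE a b = leE (sucE a) b

eqE : ∀ {n} → Exp n → Exp n → Exp n
eqE a b = andE (leE a b) (leE b a)

bexE : ∀ {n} → Exp (suc n) → Exp n → Exp n
bexE body k = recE (lit 0) (orE (var (suc zero)) (ren skip1 body)) k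

ballE : ∀ {n} → Exp (suc n) → Exp n → Exp n
ballE body k = isz (bexE (isz body) k)

nthE : ∀ {n} → Exp n → Exp n → Exp n
nthE L j = fstE (recE L (sndE (var (suc zero))) j)

ifE : ∀ {n} → Exp n → Exp n → Exp n → Exp n
ifE c a b = recE b (wk (wk a)) c

nthN : ℕ → ℕ → ℕ
nthN L j = fst (iterN L (λ _ r → snd r) j)

isZero : ℕ → ℕ
isZero = iterN 1 (λ _ _ → 0)

isZero-Truthy : ∀ v → Truthy (isZero v) ⇔ v ≡ 0
isZero-Truthy zero = (λ _ → refl) , (λ _ → s≤s z≤n)
isZero-Truthy (suc v) = (λ ()) , (λ ())

isZero-Truthy-¬ : ∀ v → Truthy (isZero v) ⇔ (¬ Truthy v)
isZero-Truthy-¬ zero    = (λ _ ()) , (λ _ → s≤s z≤n)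
isZero-Truthy-¬ (suc v) = (λ ()) , (λ ¬t → ⊥-elim (¬t (s≤s z≤n)))

or-Truthy : ∀ a b → Truthy (iterN a (λ _ _ → 1) b) ⇔ (Truthy a ⊎ Truthy b)
or-Truthy a zero = inj₁ , λ { (inj₁ x) → x ; (inj₂ ()) }
or-Truthy a (suc b) = (λ _ → inj₂ (s≤s z≤n)) , (λ _ → s≤s z≤n)

and-Truthy : ∀ a b → Truthy (isZero (iterN (isZero a) (λ _ _ → 1) (isZero b))) ⇔ (Truthy a × Truthy b)
and-Truthy zero    zero    = (λ ()) , λ { (() , _) }
and-Truthy zero    (suc b) = (λ ()) , λ { (() , _) }
and-Truthy (suc a) zero    = (λ ()) , λ { (_ , ()) }
and-Truthy (suc a) (suc b) = (λ _ → s≤s z≤n , s≤s z≤n) , (λ _ → s≤s z≤n)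

pred-sem : ∀ v → iterN 0 (λ y _ → y) v ≡ pred v
pred-sem zero = refl
pred-sem (suc v) = refl

monus-sem : ∀ a b → iterN a (λ _ r → iterN 0 (λ y _ → y) r) b ≡ a ∸ b
monus-sem a zero = refl
monus-sem a (suc b) = trans (pred-sem (iterN a (λ _ r → iterN 0 (λ y _ → y) r) b)) (trans (cong pred (monus-sem a b)) (pred[m∸n]≡m∸[1+n] a b))

bex-Truthy : ∀ (g : ℕ → ℕ → ℕ) (B : ℕ → ℕ) → (∀ y r → g y r ≡ B y) → ∀ K →
            Truthy (iterN 0 (λ y r → iterN r (λ _ _ → 1) (g y r)) K) ⇔ (Σ ℕ λ y → y < K × Truthy (B y))
bex-Truthy g B h zero = (λ ()) , λ { (y , () , _) }
bex-Truthy g B h (suc K) = to , from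
  where
  prev = iterN 0 (λ y r → iterN r (λ _ _ → 1) (g y r)) K
  to : Truthy (iterN prev (λ _ _ → 1) (g K prev)) → Σ ℕ λ y → y < suc K × Truthy (B y)
  to t with proj₁ (or-Truthy prev (g K prev)) t
  ... | inj₁ tp = let (y , lt , b) = proj₁ (bex-Truthy g B h K) tp in y , m<n⇒m<1+n lt , b
  ... | inj₂ tK = K , ≤-refl , subst Truthy (h K prev) tK
  from : (Σ ℕ λ y → y < suc K × Truthy (B y)) → Truthy (iterN prev (λ _ _ → 1) (g K prev))
  from (y , lt , b) with y ≟ K
  ... | yes refl = proj₂ (or-Truthy prev (g K prev)) (inj₂ (subst Truthy (sym (h K prev)) b))
  ... | no ne = proj₂ (or-Truthy prev (g K prev)) (inj₁ (proj₂ (bex-Truthy g B h K) (y , ≤∧≢⇒< (≤-pred lt) ne , b)))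

fromGraphCode : Code → Code
fromGraphCode c = muC (compC (compile₁ zer (isz (var zero))) c)

fromGraphCode-correct : ∀ {Y c} (f : ℕ → ℕ) → Computes Y c (graph f) → ∀ x → Eval Y (fromGraphCode c) x (f x)
fromGraphCode-correct {Y} {c} f hc x = e-mu ev0 evs
  where
  open Compile₁ Y (λ _ → 0) zer (λ m → e-zer m)
  isZero-correct : ∀ m → Eval Y (compile₁ zer (isz (var zero))) m (isZero m)
  isZero-correct = compile₁-correct (isz (var zero))
  ev0 : Eval Y (compC (compile₁ zer (isz (var zero))) c) (pair x (f x)) zero
  ev0 = e-comp (subst (λ b → Eval Y c (pair x (f x)) (if b then 1 else 0)) (graph-complete f x) (hc _)) (isZero-correct 1)
  evs : ∀ z → z < f x → Σ ℕ λ v → Eval Y (compC (compile₁ zer (isz (var zero))) c) (pair x z) (suc v)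
  evs z lt with graph f (pair x z) in gz
  ... | true = ⊥-elim (<-irrefl (sym (graph-sound f x z gz)) lt)
  ... | false = 0 , e-comp (subst (λ b → Eval Y c (pair x z) (if b then 1 else 0)) gz (hc _)) (isZero-correct 0)

module DerivedSemantics (X : SubsetOfω) (f : ℕ → ℕ) where
  open Semantics X f
  open RenamingSemantics X f

  isz-Truthy : ∀ {n} (e : Exp n) ρ → Truthy (⟦ isz e ⟧ ρ) ⇔ ⟦ e ⟧ ρ ≡ 0
  isz-Truthy e ρ = isZero-Truthy (⟦ e ⟧ ρ)

  isz-Truthy-¬ : ∀ {n} (a : Exp n) ρ → Truthy (⟦ isz a ⟧ ρ) ⇔ (¬ Truthy (⟦ a ⟧ ρ))
  isz-Truthy-¬ a ρ = isZero-Truthy-¬ (⟦ a ⟧ ρ)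

  orE-Truthy : ∀ {n} (a b : Exp n) ρ → Truthy (⟦ orE a b ⟧ ρ) ⇔ (Truthy (⟦ a ⟧ ρ) ⊎ Truthy (⟦ b ⟧ ρ))
  orE-Truthy a b ρ = or-Truthy (⟦ a ⟧ ρ) (⟦ b ⟧ ρ)

  andE-Truthy : ∀ {n} (a b : Exp n) ρ → Truthy (⟦ andE a b ⟧ ρ) ⇔ (Truthy (⟦ a ⟧ ρ) × Truthy (⟦ b ⟧ ρ))
  andE-Truthy a b ρ = and-Truthy (⟦ a ⟧ ρ) (⟦ b ⟧ ρ)

  monusE-sem : ∀ {n} (a b : Exp n) ρ → ⟦ monusE a b ⟧ ρ ≡ ⟦ a ⟧ ρ ∸ ⟦ b ⟧ ρ
  monusE-sem a b ρ = monus-sem (⟦ a ⟧ ρ) (⟦ b ⟧ ρ)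

  leE-Truthy : ∀ {n} (a b : Exp n) ρ → Truthy (⟦ leE a b ⟧ ρ) ⇔ ⟦ a ⟧ ρ ≤ ⟦ b ⟧ ρ
  leE-Truthy a b ρ =
    (λ t → m∸n≡0⇒m≤n (trans (sym (monusE-sem a b ρ)) (proj₁ (isZero-Truthy _) t))) ,
    (λ le → proj₂ (isZero-Truthy _) (trans (monusE-sem a b ρ) (m≤n⇒m∸n≡0 le)))

  ltE-Truthy : ∀ {n} (a b : Exp n) ρ → Truthy (⟦ ltE a b ⟧ ρ) ⇔ ⟦ a ⟧ ρ < ⟦ b ⟧ ρ
  ltE-Truthy a b ρ = leE-Truthy (sucE a) b ρ

  eqE-Truthy : ∀ {n} (a b : Exp n) ρ → Truthy (⟦ eqE a b ⟧ ρ) ⇔ ⟦ a ⟧ ρ ≡ ⟦ b ⟧ ρ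
  eqE-Truthy a b ρ =
    (λ t → let (p , q) = proj₁ (andE-Truthy (leE a b) (leE b a) ρ) t in
           ≤-antisym (proj₁ (leE-Truthy a b ρ) p) (proj₁ (leE-Truthy b a ρ) q)) ,
    (λ e → proj₂ (andE-Truthy (leE a b) (leE b a) ρ)
             (proj₂ (leE-Truthy a b ρ) (≤-reflexive e) , proj₂ (leE-Truthy b a ρ) (≤-reflexive (sym e))))

  bexE-Truthy : ∀ {n} (body : Exp (suc n)) (k : Exp n) ρ →
            Truthy (⟦ bexE body k ⟧ ρ) ⇔ (Σ ℕ λ y → y < ⟦ k ⟧ ρ × Truthy (⟦ body ⟧ (y ∷ᵉ ρ)))
  bexE-Truthy body k ρ =
    bex-Truthy (λ y r → ⟦ ren skip1 body ⟧ (y ∷ᵉ r ∷ᵉ ρ)) (λ y → ⟦ body ⟧ (y ∷ᵉ ρ))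
      (λ y r → ren-sem skip1 body (y ∷ᵉ r ∷ᵉ ρ) (y ∷ᵉ ρ) (λ { zero → refl ; (suc i) → refl }))
      (⟦ k ⟧ ρ)

  ballE-Truthy : ∀ {n} (body : Exp (suc n)) (k : Exp n) ρ →
             Truthy (⟦ ballE body k ⟧ ρ) ⇔ (∀ y → y < ⟦ k ⟧ ρ → Truthy (⟦ body ⟧ (y ∷ᵉ ρ)))
  ballE-Truthy body k ρ = to , from
    where
    to : Truthy (⟦ ballE body k ⟧ ρ) → ∀ y → y < ⟦ k ⟧ ρ → Truthy (⟦ body ⟧ (y ∷ᵉ ρ))
    to t y lt with Truthy-or-zero (⟦ body ⟧ (y ∷ᵉ ρ))
    ... | inj₁ holds = holds
    ... | inj₂ z with proj₁ (isZero-Truthy _) t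
    ...   | e with subst Truthy e (proj₂ (bexE-Truthy (isz body) k ρ) (y , lt , proj₂ (isZero-Truthy _) z))
    ...     | ()
    from : (∀ y → y < ⟦ k ⟧ ρ → Truthy (⟦ body ⟧ (y ∷ᵉ ρ))) → Truthy (⟦ ballE body k ⟧ ρ)
    from h with Truthy-or-zero (⟦ bexE (isz body) k ⟧ ρ)
    ... | inj₂ z = proj₂ (isZero-Truthy (⟦ bexE (isz body) k ⟧ ρ)) z
    ... | inj₁ t with proj₁ (bexE-Truthy (isz body) k ρ) t
    ...   | (y , lt , tz) = ⊥-elim (zero-not-Truthy (proj₁ (isZero-Truthy (⟦ body ⟧ (y ∷ᵉ ρ))) tz) (h y lt))

  ifE-sem : ∀ {n} (c a b : Exp n) ρ → ⟦ ifE c a b ⟧ ρ ≡ (if (⟦ c ⟧ ρ ≡ᵇ 0) then ⟦ b ⟧ ρ else ⟦ a ⟧ ρ)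
  ifE-sem c a b ρ with ⟦ c ⟧ ρ
  ... | zero = refl
  ... | suc m = trans (wk-sem (wk a) _ _) (wk-sem a _ _)

⇔-refl : ∀ {A} → A ⇔ A
⇔-refl = (λ x → x) , (λ x → x)

⇔-trans : ∀ {A B C} → A ⇔ B → B ⇔ C → A ⇔ C
⇔-trans (f , g) (h , k) = (λ x → h (f x)) , (λ x → g (k x))

⇔-× : ∀ {A B C D} → A ⇔ B → C ⇔ D → (A × C) ⇔ (B × D)
⇔-× (f , g) (h , k) = (λ { (a , c) → f a , h c }) , (λ { (b , d) → g b , k d })

⇔-⊎ : ∀ {A B C D} → A ⇔ B → C ⇔ D → (A ⊎ C) ⇔ (B ⊎ D)
⇔-⊎ (f , g) (h , k) = (λ { (inj₁ a) → inj₁ (f a) ; (inj₂ c) → inj₂ (h c) }) ,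
                      (λ { (inj₁ b) → inj₁ (g b) ; (inj₂ d) → inj₂ (k d) })

⇔-Σ< : ∀ {K} {P Q : ℕ → Set} → (∀ k → P k ⇔ Q k) → (Σ ℕ λ k → k < K × P k) ⇔ (Σ ℕ λ k → k < K × Q k)
⇔-Σ< h = (λ { (k , lt , p) → k , lt , proj₁ (h k) p }) , (λ { (k , lt , q) → k , lt , proj₂ (h k) q })

⇔-∀< : ∀ {K} {P Q : ℕ → Set} → (∀ k → P k ⇔ Q k) → (∀ k → k < K → P k) ⇔ (∀ k → k < K → Q k)
⇔-∀< h = (λ p k lt → proj₁ (h k) (p k lt)) , (λ q k lt → proj₂ (h k) (q k lt))

⇔-¬ : ∀ {A B} → A ⇔ B → (¬ A) ⇔ (¬ B)
⇔-¬ (to , from) = (λ ¬a b → ¬a (from b)) , (λ ¬b a → ¬b (to a))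

lift2s : ∀ {n m} → (Fin n → Exp m) → Fin (suc (suc n)) → Exp (suc (suc m))
lift2s σ zero = var zero
lift2s σ (suc zero) = var (suc zero)
lift2s σ (suc (suc i)) = wk (wk (σ i))

substE : ∀ {n m} → (Fin n → Exp m) → Exp n → Exp m
substE σ (var i) = σ i
substE σ (lit k) = lit k
substE σ (sucE e) = sucE (substE σ e)
substE σ (fstE e) = fstE (substE σ e)
substE σ (sndE e) = sndE (substE σ e)
substE σ (orcE e) = orcE (substE σ e)
substE σ (appF e) = appF (substE σ e)
substE σ (pairE a b) = pairE (substE σ a) (substE σ b)
substE σ (recE b s k) = recE (substE σ b) (substE (lift2s σ) s) (substE σ k)

skip0 : ∀ {n} → Fin (suc n) → Fin (suc (suc n))
skip0 zero = suc zero
skip0 (suc i) = suc (suc i)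

letE : ∀ {n} → Exp n → Exp (suc n) → Exp n
letE a body = recE a (ren skip0 body) (lit 1)

notZ : ∀ {n} → Exp n → Exp n
notZ a = isz (isz a)

earlierE : ∀ {n} → Exp n → Exp n → Exp (suc n) → Exp n
earlierE L j B = bexE (letE (nthE (wk L) (var zero)) (ren skip1 B)) j

Earlier : ℕ → ℕ → (ℕ → Set) → Set
Earlier L j Q = Σ ℕ λ k → k < j × Q (nthN L k)

module SubstitutionSemantics (X : SubsetOfω) (f : ℕ → ℕ) where
  open Semantics X f
  open RenamingSemantics X f
  open DerivedSemantics X f

  substE-sem : ∀ {n m} (σ : Fin n → Exp m) (e : Exp n) (ρ : Env m) (τ : Env n) →
               (∀ i → ⟦ σ i ⟧ ρ ≡ τ i) → ⟦ substE σ e ⟧ ρ ≡ ⟦ e ⟧ τ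
  substE-sem σ (var i) ρ τ h = h i
  substE-sem σ (lit k) ρ τ h = refl
  substE-sem σ (sucE e) ρ τ h = cong suc (substE-sem σ e ρ τ h)
  substE-sem σ (fstE e) ρ τ h = cong fst (substE-sem σ e ρ τ h)
  substE-sem σ (sndE e) ρ τ h = cong snd (substE-sem σ e ρ τ h)
  substE-sem σ (orcE e) ρ τ h = cong (λ z → if X z then 1 else 0) (substE-sem σ e ρ τ h)
  substE-sem σ (appF e) ρ τ h = cong f (substE-sem σ e ρ τ h)
  substE-sem σ (pairE a b) ρ τ h = cong₂ pair (substE-sem σ a ρ τ h) (substE-sem σ b ρ τ h)
  substE-sem σ (recE b s k) ρ τ h =
    trans (cong₂ (λ B K → iterN B (λ y r' → ⟦ substE (lift2s σ) s ⟧ (y ∷ᵉ r' ∷ᵉ ρ)) K)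
                 (substE-sem σ b ρ τ h) (substE-sem σ k ρ τ h))
          (iterN-cong (⟦ b ⟧ τ) (λ y r' → substE-sem (lift2s σ) s (y ∷ᵉ r' ∷ᵉ ρ) (y ∷ᵉ r' ∷ᵉ τ) (agree y r')) (⟦ k ⟧ τ))
    where
    agree : ∀ y r' i → ⟦ lift2s σ i ⟧ (y ∷ᵉ r' ∷ᵉ ρ) ≡ (y ∷ᵉ r' ∷ᵉ τ) i
    agree y r' zero = refl
    agree y r' (suc zero) = refl
    agree y r' (suc (suc i)) = trans (wk-sem (wk (σ i)) y (r' ∷ᵉ ρ)) (trans (wk-sem (σ i) r' ρ) (h i))

  letE-sem : ∀ {n} (a : Exp n) (body : Exp (suc n)) ρ → ⟦ letE a body ⟧ ρ ≡ ⟦ body ⟧ (⟦ a ⟧ ρ ∷ᵉ ρ)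
  letE-sem a body ρ = ren-sem skip0 body (0 ∷ᵉ ⟦ a ⟧ ρ ∷ᵉ ρ) (⟦ a ⟧ ρ ∷ᵉ ρ) (λ { zero → refl ; (suc i) → refl })

  Truthy-cong : ∀ {a b} → a ≡ b → Truthy a ⇔ Truthy b
  Truthy-cong refl = ⇔-refl

  notZ-Truthy : ∀ {n} (a : Exp n) ρ → Truthy (⟦ notZ a ⟧ ρ) ⇔ Truthy (⟦ a ⟧ ρ)
  notZ-Truthy a ρ with ⟦ a ⟧ ρ
  ... | zero = (λ ()) , (λ ())
  ... | suc m = (λ _ → s≤s z≤n) , (λ _ → s≤s z≤n)

  earlierE-Truthy : ∀ {n} (L j : Exp n) (B : Exp (suc n)) ρ →
            Truthy (⟦ earlierE L j B ⟧ ρ) ⇔ Earlier (⟦ L ⟧ ρ) (⟦ j ⟧ ρ) (λ e → Truthy (⟦ B ⟧ (e ∷ᵉ ρ)))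
  earlierE-Truthy L j B ρ = ⇔-trans (bexE-Truthy body j ρ) (⇔-Σ< λ k → Truthy-cong (trans (letE-sem a b (k ∷ᵉ ρ))
      (trans (ren-sem skip1 B _ (⟦ a ⟧ (k ∷ᵉ ρ) ∷ᵉ ρ) (λ { zero → refl ; (suc i) → refl }))
             (cong (λ z → ⟦ B ⟧ (nthN z k ∷ᵉ ρ)) (wk-sem L k ρ)))))
    where
    a = nthE (wk L) (var zero)
    b = ren skip1 B
    body = letE a b

-- Computation certificates

codeE inputE outputE tagE bodyE : ∀ {n} → Exp n → Exp n
codeE a = fstE a
inputE a = fstE (sndE a)
outputE a = sndE (sndE a)
tagE a = fstE (fstE a)
bodyE a = sndE (fstE a)

codeOf inputOf outputOf tagOf bodyOf : ℕ → ℕ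
codeOf e = fst e
inputOf e = fst (snd e)
outputOf e = snd (snd e)
tagOf e = fst (fst e)
bodyOf e = snd (fst e)

addE : ∀ {n} → Exp n → Exp n → Exp n
addE a b = recE a (sucE (var (suc zero))) b

joinIndexE : ∀ {n} → Exp n → Exp n → Exp n
joinIndexE i x = ifE i (sucE (addE x x)) (addE x x)

dbl : ℕ → ℕ
dbl x = iterN x (λ _ r → suc r) x

-- The position of x ∈ A_i in A₀ ⊕ A₁, that is 2x or 2x + 1.
joinIndex : ℕ → ℕ → ℕ
joinIndex i x = iterN (dbl x) (λ _ _ → suc (dbl x)) i

predN : ℕ → ℕ
predN v = iterN 0 (λ y _ → y) v

-- An entry ⟨c , ⟨x , v⟩⟩ of a trace claims Eval (decode c) x v. JustifiedBy oq ear c x v says that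
-- the claim follows by one Eval rule for the constructor tagged fst c (subprograms in snd c) from
-- earlier entries, where ear Q means that some earlier entry satisfies Q and oq is the oracle.
JustifiedBy : (ℕ → ℕ) → ((ℕ → Set) → Set) → ℕ → ℕ → ℕ → Set
JustifiedBy oq ear c x v =
  (t ≡ 2 × v ≡ suc x) ⊎ (t ≡ 3 × v ≡ x) ⊎ (t ≡ 4 × v ≡ fst x) ⊎ (t ≡ 5 × v ≡ snd x) ⊎ (t ≡ 6 × v ≡ oq x) ⊎
  (t ≡ 7 × ear (λ e1 → codeOf e1 ≡ snd r × (inputOf e1 ≡ x × ear (λ e2 → e2 ≡ pair (fst r) (pair (outputOf e1) v))))) ⊎
  (t ≡ 8 × ear (λ e1 → codeOf e1 ≡ fst r × (inputOf e1 ≡ x ×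
               ear (λ e2 → codeOf e2 ≡ snd r × (inputOf e2 ≡ x × v ≡ pair (outputOf e1) (outputOf e2)))))) ⊎
  (t ≡ 9 × ((snd x ≡ 0 × ear (λ e1 → e1 ≡ pair (fst r) (pair (fst x) v))) ⊎
            (Truthy (snd x) × ear (λ e1 → codeOf e1 ≡ c × (inputOf e1 ≡ pair (fst x) (predN (snd x)) ×
                 ear (λ e2 → e2 ≡ pair (snd r) (pair (pair (pair (fst x) (predN (snd x))) (outputOf e1)) v))))))) ⊎
  (t ≡ 10 × (ear (λ e1 → e1 ≡ pair r (pair (pair x v) 0)) ×
             (∀ z → z < v → ear (λ e1 → codeOf e1 ≡ r × (inputOf e1 ≡ pair x z × Truthy (outputOf e1)))))) ⊎
  ((t < 2 ⊎ 10 < t) × v ≡ 0)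
  where
  t = fst c
  r = snd c

pattern by-suc    p = inj₁ p
pattern by-id     p = inj₂ (inj₁ p)
pattern by-fst    p = inj₂ (inj₂ (inj₁ p))
pattern by-snd    p = inj₂ (inj₂ (inj₂ (inj₁ p)))
pattern by-oracle p = inj₂ (inj₂ (inj₂ (inj₂ (inj₁ p))))
pattern by-comp   p = inj₂ (inj₂ (inj₂ (inj₂ (inj₂ (inj₁ p)))))
pattern by-pair   p = inj₂ (inj₂ (inj₂ (inj₂ (inj₂ (inj₂ (inj₁ p))))))
pattern by-rec    p = inj₂ (inj₂ (inj₂ (inj₂ (inj₂ (inj₂ (inj₂ (inj₁ p)))))))
pattern by-mu     p = inj₂ (inj₂ (inj₂ (inj₂ (inj₂ (inj₂ (inj₂ (inj₂ (inj₁ p))))))))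
pattern by-default p = inj₂ (inj₂ (inj₂ (inj₂ (inj₂ (inj₂ (inj₂ (inj₂ (inj₂ p))))))))

Justified : (ℕ → ℕ) → ((ℕ → Set) → Set) → ℕ → Set
Justified oq ear e = JustifiedBy oq ear (codeOf e) (inputOf e) (outputOf e)

v0 : ∀ {n} → Exp (suc n)
v0 = var zero
v1 : ∀ {n} → Exp (suc (suc n))
v1 = var (suc zero)
v2 : ∀ {n} → Exp (suc (suc (suc n)))
v2 = var (suc (suc zero))

compCase₄ : Exp 6
compCase₄ = eqE v0 (pairE (fstE (bodyE v2)) (pairE (outputE v1) (outputE v2)))
compCase₃ : Exp 5
compCase₃ = earlierE (var (# 3)) (var (# 2)) compCase₄
compCase₂ : Exp 5
compCase₂ = andE (eqE (inputE v0) (inputE v1)) compCase₃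
compCase₁ : Exp 5
compCase₁ = andE (eqE (codeE v0) (sndE (bodyE v1))) compCase₂
pairCase₆ : Exp 6
pairCase₆ = eqE (outputE v2) (pairE (outputE v1) (outputE v0))
pairCase₅ : Exp 6
pairCase₅ = andE (eqE (inputE v0) (inputE v2)) pairCase₆
pairCase₄ : Exp 6
pairCase₄ = andE (eqE (codeE v0) (sndE (bodyE v2))) pairCase₅
pairCase₃ : Exp 5
pairCase₃ = earlierE (var (# 3)) (var (# 2)) pairCase₄
pairCase₂ : Exp 5
pairCase₂ = andE (eqE (inputE v0) (inputE v1)) pairCase₃
pairCase₁ : Exp 5
pairCase₁ = andE (eqE (codeE v0) (fstE (bodyE v1))) pairCase₂
recZeroCase₁ : Exp 5
recZeroCase₁ = eqE v0 (pairE (fstE (bodyE v1)) (pairE (fstE (inputE v1)) (outputE v1)))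
recSucCase₄ : Exp 6
recSucCase₄ = eqE v0 (pairE (sndE (bodyE v2)) (pairE (pairE (pairE (fstE (inputE v2)) (predE (sndE (inputE v2)))) (outputE v1)) (outputE v2)))
recSucCase₃ : Exp 5
recSucCase₃ = earlierE (var (# 3)) (var (# 2)) recSucCase₄
recSucCase₂ : Exp 5
recSucCase₂ = andE (eqE (inputE v0) (pairE (fstE (inputE v1)) (predE (sndE (inputE v1))))) recSucCase₃
recSucCase₁ : Exp 5
recSucCase₁ = andE (eqE (codeE v0) (codeE v1)) recSucCase₂
muZeroCase₁ : Exp 5
muZeroCase₁ = eqE v0 (pairE (bodyE v1) (pairE (pairE (inputE v1) (outputE v1)) (lit 0)))
muBelowCase₃ : Exp 6
muBelowCase₃ = andE (eqE (inputE v0) (pairE (inputE v2) v1)) (notZ (outputE v0))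
muBelowCase₂ : Exp 6
muBelowCase₂ = andE (eqE (codeE v0) (bodyE v2)) muBelowCase₃
muBelowCase₁ : Exp 5
muBelowCase₁ = earlierE (var (# 3)) (var (# 2)) muBelowCase₂

entryTag : Exp 4
entryTag = tagE v0

sucCase idCase fstCase sndCase oracleCase compCase pairCase recCase muCase : Exp 4
sucCase = eqE (outputE v0) (sucE (inputE v0))
idCase = eqE (outputE v0) (inputE v0)
fstCase = eqE (outputE v0) (fstE (inputE v0))
sndCase = eqE (outputE v0) (sndE (inputE v0))
oracleCase = eqE (outputE v0) (orcE (joinIndexE (var (# 3)) (inputE v0)))
compCase = earlierE (var (# 2)) (var (# 1)) compCase₁
pairCase = earlierE (var (# 2)) (var (# 1)) pairCase₁
recZeroCase recSucCase : Exp 4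
recZeroCase = andE (isz (sndE (inputE v0))) (earlierE (var (# 2)) (var (# 1)) recZeroCase₁)
recSucCase = andE (notZ (sndE (inputE v0))) (earlierE (var (# 2)) (var (# 1)) recSucCase₁)
recCase = orE recZeroCase recSucCase
muZeroCase muBelowCase : Exp 4
muZeroCase = earlierE (var (# 2)) (var (# 1)) muZeroCase₁
muBelowCase = ballE muBelowCase₁ (outputE v0)
muCase = andE muZeroCase muBelowCase
defaultCase junkTag : Exp 4
junkTag = orE (ltE entryTag (lit 2)) (ltE (lit 10) entryTag)
defaultCase = andE junkTag (eqE (outputE v0) (lit 0))

taggedCase : ℕ → Exp 4 → Exp 4
taggedCase k b = andE (eqE entryTag (lit k)) b

casesFrom10 casesFrom9 casesFrom8 casesFrom7 casesFrom6 casesFrom5 casesFrom4 casesFrom3 casesFrom2 : Exp 4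
casesFrom10 = orE (taggedCase 10 muCase) defaultCase
casesFrom9 = orE (taggedCase 9 recCase) casesFrom10
casesFrom8 = orE (taggedCase 8 pairCase) casesFrom9
casesFrom7 = orE (taggedCase 7 compCase) casesFrom8
casesFrom6 = orE (taggedCase 6 oracleCase) casesFrom7
casesFrom5 = orE (taggedCase 5 sndCase) casesFrom6
casesFrom4 = orE (taggedCase 4 fstCase) casesFrom5
casesFrom3 = orE (taggedCase 3 idCase) casesFrom4
casesFrom2 = orE (taggedCase 2 sucCase) casesFrom3

-- The free variables are j, L, i: entry number j of the trace L, read with oracle A_i.
justifiedE : Exp 3
justifiedE = letE (nthE v1 v0) casesFrom2

module JustifiedSemantics (X : SubsetOfω) (f : ℕ → ℕ) where
  open Semantics X f
  open RenamingSemantics X f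
  open DerivedSemantics X f
  open SubstitutionSemantics X f

  oracleBit : ℕ → ℕ → ℕ
  oracleBit i x = if X (joinIndex i x) then 1 else 0

  module _ (e j L i : ℕ) where
    ρ : Env 4
    ρ = e ∷ᵉ j ∷ᵉ L ∷ᵉ i ∷ᵉ ρ∅
    ear = Earlier L j

    andEqE-Truthy : ∀ {n} (a b : Exp n) (c : Exp n) ρ' → Truthy (⟦ andE (eqE a b) c ⟧ ρ') ⇔ (⟦ a ⟧ ρ' ≡ ⟦ b ⟧ ρ' × Truthy (⟦ c ⟧ ρ'))
    andEqE-Truthy a b c ρ' = ⇔-trans (andE-Truthy (eqE a b) c ρ') (⇔-× (eqE-Truthy a b ρ') ⇔-refl)

    taggedCase-Truthy : ∀ k b {P} → Truthy (⟦ b ⟧ ρ) ⇔ P → Truthy (⟦ taggedCase k b ⟧ ρ) ⇔ (tagOf e ≡ k × P)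
    taggedCase-Truthy k b h = ⇔-trans (andEqE-Truthy entryTag (lit k) b ρ) (⇔-× ⇔-refl h)

    compCase-Truthy : Truthy (⟦ compCase ⟧ ρ) ⇔
         ear (λ e1 → codeOf e1 ≡ snd (bodyOf e) × (inputOf e1 ≡ inputOf e × ear (λ e2 → e2 ≡ pair (fst (bodyOf e)) (pair (outputOf e1) (outputOf e)))))
    compCase-Truthy = ⇔-trans (earlierE-Truthy (var (# 2)) (var (# 1)) compCase₁ ρ) (⇔-Σ< λ k → let e1 = nthN L k ; ρ1 = e1 ∷ᵉ ρ in
           ⇔-trans (andEqE-Truthy (codeE v0) (sndE (bodyE v1)) compCase₂ ρ1) (⇔-× ⇔-refl
             (⇔-trans (andEqE-Truthy (inputE v0) (inputE v1) compCase₃ ρ1) (⇔-× ⇔-refl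
               (⇔-trans (earlierE-Truthy (var (# 3)) (var (# 2)) compCase₄ ρ1)
                  (⇔-Σ< λ k2 → eqE-Truthy v0 (pairE (fstE (bodyE v2)) (pairE (outputE v1) (outputE v2))) (nthN L k2 ∷ᵉ ρ1)))))))

    pairCase-Truthy : Truthy (⟦ pairCase ⟧ ρ) ⇔
         ear (λ e1 → codeOf e1 ≡ fst (bodyOf e) × (inputOf e1 ≡ inputOf e ×
           ear (λ e2 → codeOf e2 ≡ snd (bodyOf e) × (inputOf e2 ≡ inputOf e × outputOf e ≡ pair (outputOf e1) (outputOf e2)))))
    pairCase-Truthy = ⇔-trans (earlierE-Truthy (var (# 2)) (var (# 1)) pairCase₁ ρ) (⇔-Σ< λ k → let e1 = nthN L k ; ρ1 = e1 ∷ᵉ ρ in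
           ⇔-trans (andEqE-Truthy (codeE v0) (fstE (bodyE v1)) pairCase₂ ρ1) (⇔-× ⇔-refl
             (⇔-trans (andEqE-Truthy (inputE v0) (inputE v1) pairCase₃ ρ1) (⇔-× ⇔-refl
               (⇔-trans (earlierE-Truthy (var (# 3)) (var (# 2)) pairCase₄ ρ1) (⇔-Σ< λ k2 → let ρ2 = nthN L k2 ∷ᵉ ρ1 in
                 ⇔-trans (andEqE-Truthy (codeE v0) (sndE (bodyE v2)) pairCase₅ ρ2) (⇔-× ⇔-refl
                   (⇔-trans (andEqE-Truthy (inputE v0) (inputE v2) pairCase₆ ρ2) (⇔-× ⇔-refl
                     (eqE-Truthy (outputE v2) (pairE (outputE v1) (outputE v0)) ρ2))))))))))

    recZeroCase-Truthy : Truthy (⟦ earlierE (var (# 2)) (var (# 1)) recZeroCase₁ ⟧ ρ) ⇔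
          ear (λ e1 → e1 ≡ pair (fst (bodyOf e)) (pair (fst (inputOf e)) (outputOf e)))
    recZeroCase-Truthy = ⇔-trans (earlierE-Truthy (var (# 2)) (var (# 1)) recZeroCase₁ ρ)
            (⇔-Σ< λ k → eqE-Truthy v0 (pairE (fstE (bodyE v1)) (pairE (fstE (inputE v1)) (outputE v1))) (nthN L k ∷ᵉ ρ))

    recSucCase-Truthy : Truthy (⟦ earlierE (var (# 2)) (var (# 1)) recSucCase₁ ⟧ ρ) ⇔
          ear (λ e1 → codeOf e1 ≡ codeOf e × (inputOf e1 ≡ pair (fst (inputOf e)) (predN (snd (inputOf e))) ×
                 ear (λ e2 → e2 ≡ pair (snd (bodyOf e)) (pair (pair (pair (fst (inputOf e)) (predN (snd (inputOf e)))) (outputOf e1)) (outputOf e)))))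
    recSucCase-Truthy = ⇔-trans (earlierE-Truthy (var (# 2)) (var (# 1)) recSucCase₁ ρ) (⇔-Σ< λ k → let e1 = nthN L k ; ρ1 = e1 ∷ᵉ ρ in
           ⇔-trans (andEqE-Truthy (codeE v0) (codeE v1) recSucCase₂ ρ1) (⇔-× ⇔-refl
             (⇔-trans (andEqE-Truthy (inputE v0) (pairE (fstE (inputE v1)) (predE (sndE (inputE v1)))) recSucCase₃ ρ1) (⇔-× ⇔-refl
               (⇔-trans (earlierE-Truthy (var (# 3)) (var (# 2)) recSucCase₄ ρ1)
                 (⇔-Σ< λ k2 → eqE-Truthy v0 (pairE (sndE (bodyE v2)) (pairE (pairE (pairE (fstE (inputE v2)) (predE (sndE (inputE v2)))) (outputE v1)) (outputE v2))) (nthN L k2 ∷ᵉ ρ1)))))))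

    recCase-Truthy : Truthy (⟦ recCase ⟧ ρ) ⇔
         ((snd (inputOf e) ≡ 0 × ear (λ e1 → e1 ≡ pair (fst (bodyOf e)) (pair (fst (inputOf e)) (outputOf e)))) ⊎
          (Truthy (snd (inputOf e)) × ear (λ e1 → codeOf e1 ≡ codeOf e × (inputOf e1 ≡ pair (fst (inputOf e)) (predN (snd (inputOf e))) ×
                 ear (λ e2 → e2 ≡ pair (snd (bodyOf e)) (pair (pair (pair (fst (inputOf e)) (predN (snd (inputOf e)))) (outputOf e1)) (outputOf e)))))))
    recCase-Truthy = ⇔-trans (orE-Truthy recZeroCase recSucCase ρ) (⇔-⊎
           (⇔-trans (andE-Truthy (isz (sndE (inputE v0))) (earlierE (var (# 2)) (var (# 1)) recZeroCase₁) ρ) (⇔-× (isz-Truthy (sndE (inputE v0)) ρ) recZeroCase-Truthy))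
           (⇔-trans (andE-Truthy (notZ (sndE (inputE v0))) (earlierE (var (# 2)) (var (# 1)) recSucCase₁) ρ) (⇔-× (notZ-Truthy (sndE (inputE v0)) ρ) recSucCase-Truthy)))

    muZeroCase-Truthy : Truthy (⟦ muZeroCase ⟧ ρ) ⇔ ear (λ e1 → e1 ≡ pair (bodyOf e) (pair (pair (inputOf e) (outputOf e)) 0))
    muZeroCase-Truthy = ⇔-trans (earlierE-Truthy (var (# 2)) (var (# 1)) muZeroCase₁ ρ)
             (⇔-Σ< λ k → eqE-Truthy v0 (pairE (bodyE v1) (pairE (pairE (inputE v1) (outputE v1)) (lit 0))) (nthN L k ∷ᵉ ρ))

    muBelowCase-Truthy : Truthy (⟦ muBelowCase ⟧ ρ) ⇔
           (∀ z → z < outputOf e → ear (λ e1 → codeOf e1 ≡ bodyOf e × (inputOf e1 ≡ pair (inputOf e) z × Truthy (outputOf e1))))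
    muBelowCase-Truthy = ⇔-trans (ballE-Truthy muBelowCase₁ (outputE v0) ρ) (⇔-∀< λ z → let ρz = z ∷ᵉ ρ in
             ⇔-trans (earlierE-Truthy (var (# 3)) (var (# 2)) muBelowCase₂ ρz) (⇔-Σ< λ k → let ρ1 = nthN L k ∷ᵉ ρz in
               ⇔-trans (andEqE-Truthy (codeE v0) (bodyE v2) muBelowCase₃ ρ1) (⇔-× ⇔-refl
                 (⇔-trans (andEqE-Truthy (inputE v0) (pairE (inputE v2) v1) (notZ (outputE v0)) ρ1) (⇔-× ⇔-refl (notZ-Truthy (outputE v0) ρ1))))))

    muCase-Truthy : Truthy (⟦ muCase ⟧ ρ) ⇔ (ear (λ e1 → e1 ≡ pair (bodyOf e) (pair (pair (inputOf e) (outputOf e)) 0)) ×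
             (∀ z → z < outputOf e → ear (λ e1 → codeOf e1 ≡ bodyOf e × (inputOf e1 ≡ pair (inputOf e) z × Truthy (outputOf e1)))))
    muCase-Truthy = ⇔-trans (andE-Truthy muZeroCase muBelowCase ρ) (⇔-× muZeroCase-Truthy muBelowCase-Truthy)

    defaultCase-Truthy : Truthy (⟦ defaultCase ⟧ ρ) ⇔ ((tagOf e < 2 ⊎ 10 < tagOf e) × outputOf e ≡ 0)
    defaultCase-Truthy = ⇔-trans (andE-Truthy junkTag (eqE (outputE v0) (lit 0)) ρ) (⇔-× (⇔-trans (orE-Truthy (ltE entryTag (lit 2)) (ltE (lit 10) entryTag) ρ)
              (⇔-⊎ (ltE-Truthy entryTag (lit 2) ρ) (ltE-Truthy (lit 10) entryTag ρ))) (eqE-Truthy (outputE v0) (lit 0) ρ))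

    orCase-Truthy : ∀ (a b : Exp 4) {P Q} → Truthy (⟦ a ⟧ ρ) ⇔ P → Truthy (⟦ b ⟧ ρ) ⇔ Q → Truthy (⟦ orE a b ⟧ ρ) ⇔ (P ⊎ Q)
    orCase-Truthy a b h1 h2 = ⇔-trans (orE-Truthy a b ρ) (⇔-⊎ h1 h2)

    casesFrom2-Truthy : Truthy (⟦ casesFrom2 ⟧ ρ) ⇔ Justified (oracleBit i) ear e
    casesFrom2-Truthy =
      orCase-Truthy (taggedCase 2 sucCase) casesFrom3 (taggedCase-Truthy 2 sucCase (eqE-Truthy (outputE v0) (sucE (inputE v0)) ρ)) (
      orCase-Truthy (taggedCase 3 idCase) casesFrom4 (taggedCase-Truthy 3 idCase (eqE-Truthy (outputE v0) (inputE v0) ρ)) (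
      orCase-Truthy (taggedCase 4 fstCase) casesFrom5 (taggedCase-Truthy 4 fstCase (eqE-Truthy (outputE v0) (fstE (inputE v0)) ρ)) (
      orCase-Truthy (taggedCase 5 sndCase) casesFrom6 (taggedCase-Truthy 5 sndCase (eqE-Truthy (outputE v0) (sndE (inputE v0)) ρ)) (
      orCase-Truthy (taggedCase 6 oracleCase) casesFrom7 (taggedCase-Truthy 6 oracleCase (eqE-Truthy (outputE v0) (orcE (joinIndexE (var (# 3)) (inputE v0))) ρ)) (
      orCase-Truthy (taggedCase 7 compCase) casesFrom8 (taggedCase-Truthy 7 compCase compCase-Truthy) (
      orCase-Truthy (taggedCase 8 pairCase) casesFrom9 (taggedCase-Truthy 8 pairCase pairCase-Truthy) (
      orCase-Truthy (taggedCase 9 recCase) casesFrom10 (taggedCase-Truthy 9 recCase recCase-Truthy) (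
      orCase-Truthy (taggedCase 10 muCase) defaultCase (taggedCase-Truthy 10 muCase muCase-Truthy) defaultCase-Truthy))))))))

  justifiedE-Truthy : ∀ j L i → Truthy (⟦ justifiedE ⟧ (j ∷ᵉ L ∷ᵉ i ∷ᵉ ρ∅)) ⇔ Justified (oracleBit i) (Earlier L j) (nthN L j)
  justifiedE-Truthy j L i = ⇔-trans (Truthy-cong (letE-sem (nthE v1 v0) casesFrom2 (j ∷ᵉ L ∷ᵉ i ∷ᵉ ρ∅))) (casesFrom2-Truthy (nthN L j) j L i)

ValidTrace : (ℕ → ℕ) → ℕ → ℕ → Set
ValidTrace oq L N = ∀ j → j < N → Justified oq (Earlier L j) (nthN L j)

-- C = ⟨N , L⟩ where L codes a valid trace of length N containing the entry ⟨c , ⟨x , v⟩⟩.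
Certificate : (ℕ → ℕ) → ℕ → ℕ → ℕ → ℕ → Set
Certificate oq c x v C = ValidTrace oq (snd C) (fst C) × (Σ ℕ λ j → j < fst C × nthN (snd C) j ≡ pair c (pair x v))

tag-default : ∀ t (d : ℕ → Code) r → (t < 2 ⊎ 10 < t) → decodeTag t d r ≡ zer
tag-default 0 d r _ = refl
tag-default 1 d r _ = refl
tag-default (suc (suc (suc (suc (suc (suc (suc (suc (suc (suc (suc t))))))))))) d r _ = refl
tag-default (suc (suc t)) d r (inj₁ (s≤s (s≤s ())))
tag-default 2 d r (inj₂ (s≤s (s≤s ())))
tag-default 3 d r (inj₂ (s≤s (s≤s (s≤s ()))))
tag-default 4 d r (inj₂ (s≤s (s≤s (s≤s (s≤s ())))))
tag-default 5 d r (inj₂ (s≤s (s≤s (s≤s (s≤s (s≤s ()))))))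
tag-default 6 d r (inj₂ (s≤s (s≤s (s≤s (s≤s (s≤s (s≤s ())))))))
tag-default 7 d r (inj₂ (s≤s (s≤s (s≤s (s≤s (s≤s (s≤s (s≤s ()))))))))
tag-default 8 d r (inj₂ (s≤s (s≤s (s≤s (s≤s (s≤s (s≤s (s≤s (s≤s ())))))))))
tag-default 9 d r (inj₂ (s≤s (s≤s (s≤s (s≤s (s≤s (s≤s (s≤s (s≤s (s≤s ()))))))))))
tag-default 10 d r (inj₂ (s≤s (s≤s (s≤s (s≤s (s≤s (s≤s (s≤s (s≤s (s≤s (s≤s ())))))))))))

decode-tagged : ∀ c {k} → fst c ≡ k → decode c ≡ decodeTag k decode (snd c)
decode-tagged c eq = trans (decode-unfold c) (cong (λ t → decodeTag t decode (snd c)) eq)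

Truthy⇒suc-pred : ∀ n → Truthy n → n ≡ suc (predN n)
Truthy⇒suc-pred (suc n) _ = refl

module CertificateSoundness (Y : SubsetOfω) (oq : ℕ → ℕ) (hoq : ∀ x → oq x ≡ (if Y x then 1 else 0)) where

  EntryHolds : ℕ → Set
  EntryHolds e = Eval Y (decode (codeOf e)) (inputOf e) (outputOf e)

  Eval-decode-cong : ∀ {C C' X X' V V'} → C ≡ C' → X ≡ X' → V ≡ V' → Eval Y (decode C) X V → Eval Y (decode C') X' V'
  Eval-decode-cong refl refl refl e = e

  entry-Eval : ∀ e c x v → e ≡ pair c (pair x v) → EntryHolds e → Eval Y (decode c) x v
  entry-Eval e c x v refl ev =
    Eval-decode-cong (fst-pair c (pair x v)) (trans (cong fst (snd-pair c (pair x v))) (fst-pair x v))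
          (trans (cong snd (snd-pair c (pair x v))) (snd-pair x v)) ev

  entry-Eval′ : ∀ e c x → codeOf e ≡ c → inputOf e ≡ x → EntryHolds e → Eval Y (decode c) x (outputOf e)
  entry-Eval′ e c x refl refl ev = ev

  Eval-program-cong : ∀ {C C' x v} → C ≡ C' → Eval Y C' x v → Eval Y C x v
  Eval-program-cong refl ev = ev

  justified-sound : ∀ {ear : (ℕ → Set) → Set} → (∀ {Q} → ear Q → Σ ℕ λ e1 → EntryHolds e1 × Q e1) →
          ∀ c x v → JustifiedBy oq ear c x v → Eval Y (decode c) x v
  justified-sound E c x v (by-suc (t , ev)) = Eval-program-cong (decode-tagged c t) (subst (Eval Y sucC x) (sym ev) (e-suc x))
  justified-sound E c x v (by-id (t , ev)) = Eval-program-cong (decode-tagged c t) (subst (Eval Y idC x) (sym ev) (e-id x))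
  justified-sound E c x v (by-fst (t , ev)) = Eval-program-cong (decode-tagged c t) (subst (Eval Y fstC x) (sym ev) (e-fst x))
  justified-sound E c x v (by-snd (t , ev)) = Eval-program-cong (decode-tagged c t) (subst (Eval Y sndC x) (sym ev) (e-snd x))
  justified-sound E c x v (by-oracle (t , ev)) =
    Eval-program-cong (decode-tagged c t) (subst (Eval Y orcC x) (sym (trans ev (hoq x))) (e-orc x))
  justified-sound E c x v (by-comp (t , a)) with E a
  ... | (e1 , ev1 , cd1 , inp1 , a2) with E a2
  ...   | (e2 , ev2 , eq2) =
    Eval-program-cong (decode-tagged c t) (e-comp (entry-Eval′ e1 (snd (snd c)) x cd1 inp1 ev1) (entry-Eval e2 (fst (snd c)) (outputOf e1) v eq2 ev2))
  justified-sound E c x v (by-pair (t , a)) with E a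
  ... | (e1 , ev1 , cd1 , inp1 , a2) with E a2
  ...   | (e2 , ev2 , cd2 , inp2 , veq) =
    Eval-program-cong (decode-tagged c t)
      (subst (Eval Y (pairC (decode (fst (snd c))) (decode (snd (snd c)))) x) (sym veq)
        (e-pair (entry-Eval′ e1 (fst (snd c)) x cd1 inp1 ev1) (entry-Eval′ e2 (snd (snd c)) x cd2 inp2 ev2)))
  justified-sound E c x v (by-rec (t , inj₁ (s0 , a))) with E a
  ... | (e1 , ev1 , eq1) =
    Eval-program-cong (decode-tagged c t)
      (subst (λ X' → Eval Y (recC (decode (fst (snd c))) (decode (snd (snd c)))) X' v) xeq
        (e-rec0 {a = fst x} (entry-Eval e1 (fst (snd c)) (fst x) v eq1 ev1)))
    where
    xeq : pair (fst x) 0 ≡ x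
    xeq = trans (cong (pair (fst x)) (sym s0)) (pair-unpair x)
  justified-sound E c x v (by-rec (t , inj₂ (tr , a))) with E a
  ... | (e1 , ev1 , cd1 , inp1 , a2) with E a2
  ...   | (e2 , ev2 , eq2) =
    Eval-program-cong (decode-tagged c t) (subst (λ X' → Eval Y (recC (decode (fst (snd c))) (decode (snd (snd c)))) X' v) xeq
      (e-recS {a = fst x} {y = predN (snd x)} (Eval-program-cong (sym (decode-tagged c t)) (entry-Eval′ e1 c (pair (fst x) (predN (snd x))) cd1 inp1 ev1))
         (entry-Eval e2 (snd (snd c)) (pair (pair (fst x) (predN (snd x))) (outputOf e1)) v eq2 ev2)))
    where
    xeq : pair (fst x) (suc (predN (snd x))) ≡ x
    xeq = trans (cong (pair (fst x)) (sym (Truthy⇒suc-pred (snd x) tr))) (pair-unpair x)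
  justified-sound E c x v (by-mu (t , a , h)) with E a
  ... | (e1 , ev1 , eq1) =
    Eval-program-cong (decode-tagged c t) (e-mu (entry-Eval e1 (snd c) (pair x v) 0 eq1 ev1) λ z lt → nonzero-below z lt (E (h z lt)))
    where
    nonzero-below : ∀ z → z < v → (Σ ℕ λ e1 → EntryHolds e1 × (codeOf e1 ≡ snd c × (inputOf e1 ≡ pair x z × Truthy (outputOf e1)))) →
         Σ ℕ λ w → Eval Y (decode (snd c)) (pair x z) (suc w)
    nonzero-below z lt (e1 , ev1 , cd1 , inp1 , tr) =
      predN (outputOf e1) ,
      subst (Eval Y (decode (snd c)) (pair x z)) (Truthy⇒suc-pred (outputOf e1) tr) (entry-Eval′ e1 (snd c) (pair x z) cd1 inp1 ev1)
  justified-sound E c x v (by-default (d , v0)) =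
    Eval-program-cong (trans (decode-unfold c) (tag-default (fst c) decode (snd c) d)) (subst (Eval Y zer x) (sym v0) (e-zer x))

  trace-sound : ∀ L N → ValidTrace oq L N → ∀ n j → j < n → j < N → EntryHolds (nthN L j)
  trace-sound L N V (suc n) j j<sn jN = justified-sound E _ _ _ (V j jN)
    where
    E : ∀ {Q} → Earlier L j Q → Σ ℕ λ e1 → EntryHolds e1 × Q e1
    E (k , k<j , q) = nthN L k , trace-sound L N V n k (≤-trans k<j (≤-pred j<sn)) (<-trans k<j jN) , q

  certificate-sound : ∀ {c x v C} → Certificate oq c x v C → Eval Y (decode c) x v
  certificate-sound {c} {x} {v} {C} (V , j , lt , eq) = entry-Eval (nthN (snd C) j) c x v eq (trace-sound (snd C) (fst C) V (suc j) j ≤-refl lt)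

encodeList : List ℕ → ℕ
encodeList [] = 0
encodeList (a ∷ l) = pair a (encodeList l)

sndIt : ℕ → ℕ → ℕ
sndIt k L = iterN L (λ _ r → snd r) k

sndIt-front : ∀ k L → sndIt (suc k) L ≡ sndIt k (snd L)
sndIt-front zero L = refl
sndIt-front (suc k) L = cong snd (sndIt-front k L)

sndIt-cons : ∀ k a L → sndIt (suc k) (pair a L) ≡ sndIt k L
sndIt-cons k a L = trans (sndIt-front k (pair a L)) (cong (sndIt k) (snd-pair a L))

sndIt-shift : ∀ l m k → sndIt (length l + k) (encodeList (l ++ m)) ≡ sndIt k (encodeList m)
sndIt-shift [] m k = refl
sndIt-shift (a ∷ l) m k = trans (sndIt-cons (length l + k) a (encodeList (l ++ m))) (sndIt-shift l m k)

nth-shift : ∀ l m k → nthN (encodeList (l ++ m)) (length l + k) ≡ nthN (encodeList m) k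
nth-shift l m k = cong fst (sndIt-shift l m k)

nth-prefix : ∀ l m k → k < length l → nthN (encodeList (l ++ m)) k ≡ nthN (encodeList l) k
nth-prefix (a ∷ l) m zero _ = trans (fst-pair a _) (sym (fst-pair a _))
nth-prefix (a ∷ l) m (suc k) (s≤s lt) =
  trans (cong fst (sndIt-cons k a (encodeList (l ++ m))))
        (trans (nth-prefix l m k lt) (sym (cong fst (sndIt-cons k a (encodeList l)))))

Occurs : List ℕ → ℕ → Set
Occurs l t = Σ ℕ λ j → j < length l × nthN (encodeList l) j ≡ t

Occurs-++ˡ : ∀ l m {t} → Occurs l t → Occurs (l ++ m) t
Occurs-++ˡ l m (j , lt , eq) = j , subst (j <_) (sym (length-++ l)) (≤-trans lt (m≤m+n _ _)) , trans (nth-prefix l m j lt) eq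

Occurs-++ʳ : ∀ l m {t} → Occurs m t → Occurs (l ++ m) t
Occurs-++ʳ l m (j , lt , eq) = length l + j , subst (length l + j <_) (sym (length-++ l)) (+-monoʳ-< (length l) lt) ,
  trans (nth-shift l m j) eq

Occurs-last : ∀ l t → Occurs (l ++ [ t ]) t
Occurs-last l t = length l + 0 , subst (length l + 0 <_) (sym (length-++ l)) (+-monoʳ-< (length l) (s≤s z≤n)) ,
  trans (nth-shift l [ t ] 0) (fst-pair t 0)

Earlier-mono : ∀ {L j} {P Q : ℕ → Set} → (∀ a → P a → Q a) → Earlier L j P → Earlier L j Q
Earlier-mono h (k , lt , p) = k , lt , h _ p

Earlier-prefix : ∀ l m j {Q} → j ≤ length l → Earlier (encodeList l) j Q → Earlier (encodeList (l ++ m)) j Q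
Earlier-prefix l m j {Q} le (k , lt , q) = k , lt , subst Q (sym (nth-prefix l m k (<-≤-trans lt le))) q

Earlier-shift : ∀ l m j {Q} → Earlier (encodeList m) j Q → Earlier (encodeList (l ++ m)) (length l + j) Q
Earlier-shift l m j {Q} (k , lt , q) = length l + k , +-monoʳ-< (length l) lt , subst Q (sym (nth-shift l m k)) q

Earlier-occurs : ∀ l m {t} (Q : ℕ → Set) → Occurs l t → Q t → Earlier (encodeList (l ++ m)) (length l) Q
Earlier-occurs l m Q (j , lt , eq) q = j , lt , subst Q (sym (trans (nth-prefix l m j lt) eq)) q

module _ {oq : ℕ → ℕ} where
  JustifiedBy-mono : ∀ {ear₁ ear₂ : (ℕ → Set) → Set} → (∀ {P} → ear₁ P → ear₂ P) →
               (∀ {P Q} → (∀ a → P a → Q a) → ear₁ P → ear₁ Q) →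
               ∀ {c x v} → JustifiedBy oq ear₁ c x v → JustifiedBy oq ear₂ c x v
  JustifiedBy-mono cv mn (by-suc a) = by-suc a
  JustifiedBy-mono cv mn (by-id a) = by-id a
  JustifiedBy-mono cv mn (by-fst a) = by-fst a
  JustifiedBy-mono cv mn (by-snd a) = by-snd a
  JustifiedBy-mono cv mn (by-oracle a) = by-oracle a
  JustifiedBy-mono cv mn (by-comp (t , a)) =
    by-comp (t , cv (mn (λ { e1 (p , q , r) → p , q , cv r }) a))
  JustifiedBy-mono cv mn (by-pair (t , a)) =
    by-pair (t , cv (mn (λ { e1 (p , q , r) → p , q , cv r }) a))
  JustifiedBy-mono cv mn (by-rec (t , inj₁ (s , a))) =
    by-rec (t , inj₁ (s , cv a))
  JustifiedBy-mono cv mn (by-rec (t , inj₂ (s , a))) =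
    by-rec (t , inj₂ (s , cv (mn (λ { e1 (p , q , r) → p , q , cv r }) a)))
  JustifiedBy-mono cv mn (by-mu (t , a , h)) =
    by-mu (t , cv a , λ z lt → cv (h z lt))
  JustifiedBy-mono cv mn (by-default a) =
    by-default a

  ValidTrace-++ : ∀ l m → ValidTrace oq (encodeList l) (length l) → ValidTrace oq (encodeList m) (length m) →
             ValidTrace oq (encodeList (l ++ m)) (length (l ++ m))
  ValidTrace-++ l m V1 V2 j lt with j <? length l
  ... | yes jl = subst (Justified oq (Earlier (encodeList (l ++ m)) j)) (sym (nth-prefix l m j jl))
                   (JustifiedBy-mono (λ {P} → Earlier-prefix l m j {P} (<⇒≤ jl)) (λ {P} {Q} → Earlier-mono {P = P} {Q = Q})
                      {codeOf e0} {inputOf e0} {outputOf e0} (V1 j jl))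
    where e0 = nthN (encodeList l) j
  ... | no jl = subst (λ J → Justified oq (Earlier (encodeList (l ++ m)) J) (nthN (encodeList (l ++ m)) J)) jeq
                  (subst (Justified oq (Earlier (encodeList (l ++ m)) (length l + j'))) (sym (nth-shift l m j'))
                    (JustifiedBy-mono (λ {P} → Earlier-shift l m j' {P}) (λ {P} {Q} → Earlier-mono {P = P} {Q = Q}) {codeOf e1} {inputOf e1} {outputOf e1} (V2 j' j'lt)))
    where
    j' = j ∸ length l
    e1 = nthN (encodeList m) j'
    jeq : length l + j' ≡ j
    jeq = m+[n∸m]≡n (≮⇒≥ jl)
    j'lt : j' < length m
    j'lt = +-cancelˡ-< (length l) j' (length m) (subst₂ _<_ (sym jeq) (length-++ l) lt)

  ValidTrace-snoc : ∀ l t → ValidTrace oq (encodeList l) (length l) →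
               JustifiedBy oq (Earlier (encodeList (l ++ [ t ])) (length l)) (codeOf t) (inputOf t) (outputOf t) →
               ValidTrace oq (encodeList (l ++ [ t ])) (length (l ++ [ t ]))
  ValidTrace-snoc l t V J j lt with j <? length l
  ... | yes jl = subst (Justified oq (Earlier (encodeList (l ++ [ t ])) j)) (sym (nth-prefix l [ t ] j jl))
                   (JustifiedBy-mono (λ {P} → Earlier-prefix l [ t ] j {P} (<⇒≤ jl)) (λ {P} {Q} → Earlier-mono {P = P} {Q = Q})
                      {codeOf e0} {inputOf e0} {outputOf e0} (V j jl))
    where e0 = nthN (encodeList l) j
  ... | no jl = subst (λ J' → Justified oq (Earlier (encodeList (l ++ [ t ])) J') (nthN (encodeList (l ++ [ t ])) J')) jeq
                  (subst (Justified oq (Earlier (encodeList (l ++ [ t ])) (length l))) (sym ntheq) J)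
    where
    jeq : length l ≡ j
    jeq = ≤-antisym (≮⇒≥ jl) (≤-pred (subst (j <_) (trans (length-++ l) (+-comm (length l) 1)) lt))
    ntheq : nthN (encodeList (l ++ [ t ])) (length l) ≡ t
    ntheq = trans (cong (nthN (encodeList (l ++ [ t ]))) (sym (+-identityʳ (length l))))
              (trans (nth-shift l [ t ] 0) (fst-pair t 0))

entry : ℕ → ℕ → ℕ → ℕ
entry c x v = pair c (pair x v)

codeOf-entry : ∀ c x v → codeOf (entry c x v) ≡ c
codeOf-entry c x v = fst-pair c (pair x v)

inputOf-entry : ∀ c x v → inputOf (entry c x v) ≡ x
inputOf-entry c x v = trans (cong fst (snd-pair c (pair x v))) (fst-pair x v)

outputOf-entry : ∀ c x v → outputOf (entry c x v) ≡ v
outputOf-entry c x v = trans (cong snd (snd-pair c (pair x v))) (snd-pair x v)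

module CertificateCompleteness (Y : SubsetOfω) (oq : ℕ → ℕ) (hoq : ∀ x → oq x ≡ (if Y x then 1 else 0)) where

  castJ' : ∀ {ear C C' X X' V V'} → C ≡ C' → X ≡ X' → V ≡ V' → JustifiedBy oq ear C X V → JustifiedBy oq ear C' X' V'
  castJ' refl refl refl j = j

  castJ : ∀ {ear} c x v → JustifiedBy oq ear c x v → Justified oq ear (entry c x v)
  castJ {ear} c x v = castJ' {ear} (sym (codeOf-entry c x v)) (sym (inputOf-entry c x v)) (sym (outputOf-entry c x v))

  record Traced (p : Code) (x v : ℕ) : Set where
    constructor traced
    field
      steps  : List ℕ
      valid  : ValidTrace oq (encodeList steps) (length steps)
      occurs : Occurs steps (entry (encode p) x v)

  traced-step : ∀ l p x v → ValidTrace oq (encodeList l) (length l) →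
    let c = encode p in JustifiedBy oq (Earlier (encodeList (l ++ [ entry c x v ])) (length l)) c x v → Traced p x v
  traced-step l p x v V J =
    traced (l ++ [ entry c x v ])
           (ValidTrace-snoc {oq} l (entry c x v) V (castJ {Earlier (encodeList (l ++ [ entry c x v ])) (length l)} c x v J))
           (Occurs-last l (entry c x v))
    where c = encode p

  ValidTrace-[] : ValidTrace oq (encodeList []) 0
  ValidTrace-[] j ()

  traced-comp : ∀ {f g x y z} → Traced g x y → Traced f y z → Traced (compC f g) x z
  traced-comp {f} {g} {x} {y} {z} (traced l1 V1 I1) (traced l2 V2 I2) =
    traced-step l P x z (ValidTrace-++ {oq} l1 l2 V1 V2)
      (by-comp (fst-pair 7 (pair ef eg) ,
        Earlier-occurs l [ E ] Q1 (Occurs-++ˡ l1 l2 I1)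
          (trans (codeOf-entry eg x y) (sym (outputOf-entry 7 ef eg)) , inputOf-entry eg x y ,
           Earlier-occurs l [ E ] (Q2 (entry eg x y)) (Occurs-++ʳ l1 l2 I2)
             (cong₂ pair (sym (inputOf-entry 7 ef eg)) (cong (λ w → pair w z) (sym (outputOf-entry eg x y)))))))
    where
    ef = encode f
    eg = encode g
    P = compC f g
    C = encode P
    l = l1 ++ l2
    E = entry C x z
    ear = Earlier (encodeList (l ++ [ E ])) (length l)
    Q2 : ℕ → ℕ → Set
    Q2 e1 e2 = e2 ≡ pair (fst (snd C)) (pair (outputOf e1) z)
    Q1 : ℕ → Set
    Q1 e1 = codeOf e1 ≡ snd (snd C) × (inputOf e1 ≡ x × ear (Q2 e1))

  traced-pair : ∀ {f g x a b} → Traced f x a → Traced g x b → Traced (pairC f g) x (pair a b)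
  traced-pair {f} {g} {x} {a} {b} (traced l1 V1 I1) (traced l2 V2 I2) =
    traced-step l P x (pair a b) (ValidTrace-++ {oq} l1 l2 V1 V2)
      (by-pair (fst-pair 8 (pair ef eg) ,
        Earlier-occurs l [ E ] Q1 (Occurs-++ˡ l1 l2 I1)
          (trans (codeOf-entry ef x a) (sym (inputOf-entry 8 ef eg)) , inputOf-entry ef x a ,
           Earlier-occurs l [ E ] (Q2 (entry ef x a)) (Occurs-++ʳ l1 l2 I2)
             (trans (codeOf-entry eg x b) (sym (outputOf-entry 8 ef eg)) , inputOf-entry eg x b ,
              cong₂ pair (sym (outputOf-entry ef x a)) (sym (outputOf-entry eg x b))))))
    where
    ef = encode f
    eg = encode g
    P = pairC f g
    C = encode P
    l = l1 ++ l2
    E = entry C x (pair a b)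
    ear = Earlier (encodeList (l ++ [ E ])) (length l)
    Q2 : ℕ → ℕ → Set
    Q2 e1 e2 = codeOf e2 ≡ snd (snd C) × (inputOf e2 ≡ x × pair a b ≡ pair (outputOf e1) (outputOf e2))
    Q1 : ℕ → Set
    Q1 e1 = codeOf e1 ≡ fst (snd C) × (inputOf e1 ≡ x × ear (Q2 e1))

  traced-rec0 : ∀ {f g a z} → Traced f a z → Traced (recC f g) (pair a 0) z
  traced-rec0 {f} {g} {a} {z} (traced l1 V1 I1) =
    traced-step l1 P (pair a 0) z V1
      (by-rec (fst-pair 9 (pair ef eg) ,
        inj₁ (snd-pair a 0 , Earlier-occurs l1 [ E ] Q1 I1
          (cong₂ pair (sym (inputOf-entry 9 ef eg)) (cong (λ w → pair w z) (sym (fst-pair a 0)))))))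
    where
    ef = encode f
    eg = encode g
    P = recC f g
    C = encode P
    E = entry C (pair a 0) z
    Q1 : ℕ → Set
    Q1 e1 = e1 ≡ pair (fst (snd C)) (pair (fst (pair a 0)) z)

  traced-recS : ∀ {f g a y z w} → Traced (recC f g) (pair a y) z → Traced g (pair (pair a y) z) w →
                Traced (recC f g) (pair a (suc y)) w
  traced-recS {f} {g} {a} {y} {z} {w} (traced l1 V1 I1) (traced l2 V2 I2) =
    traced-step l P x w (ValidTrace-++ {oq} l1 l2 V1 V2)
      (by-rec (fst-pair 9 (pair ef eg) ,
        inj₂ (subst Truthy (sym (snd-pair a (suc y))) (s≤s z≤n) ,
          Earlier-occurs l [ E ] Q1 (Occurs-++ˡ l1 l2 I1)
            (codeOf-entry C (pair a y) z , trans (inputOf-entry C (pair a y) z) axeq ,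
             Earlier-occurs l [ E ] (Q2 (entry C (pair a y) z)) (Occurs-++ʳ l1 l2 I2)
               (cong₂ pair (sym (outputOf-entry 9 ef eg))
                  (cong (λ q → pair q w) (cong₂ pair axeq (sym (outputOf-entry C (pair a y) z)))))))))
    where
    ef = encode f
    eg = encode g
    P = recC f g
    C = encode P
    x = pair a (suc y)
    l = l1 ++ l2
    E = entry C x w
    ear = Earlier (encodeList (l ++ [ E ])) (length l)
    axeq : pair a y ≡ pair (fst x) (predN (snd x))
    axeq = cong₂ pair (sym (fst-pair a (suc y))) (cong predN (sym (snd-pair a (suc y))))
    Q2 : ℕ → ℕ → Set
    Q2 e1 e2 = e2 ≡ pair (snd (snd C)) (pair (pair (pair (fst x) (predN (snd x))) (outputOf e1)) w)
    Q1 : ℕ → Set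
    Q1 e1 = codeOf e1 ≡ C × (inputOf e1 ≡ pair (fst x) (predN (snd x)) × ear (Q2 e1))

  TracedBelow : Code → ℕ → ℕ → Set
  TracedBelow f x n = Σ (List ℕ) λ l → ValidTrace oq (encodeList l) (length l) ×
                        (∀ z → z < n → Σ ℕ λ w → Occurs l (entry (encode f) (pair x z) (suc w)))

  traced-below : ∀ f x n → (∀ z → z < n → Σ ℕ λ w → Traced f (pair x z) (suc w)) → TracedBelow f x n
  traced-below f x zero    _  = [] , ValidTrace-[] , (λ z ())
  traced-below f x (suc n) ts with traced-below f x n (λ z z<n → ts z (m<n⇒m<1+n z<n)) | ts n ≤-refl
  ... | (l , V , I) | (w , traced ln Vn In) = l ++ ln , ValidTrace-++ {oq} l ln V Vn , find
    where
    find : ∀ z → z < suc n → Σ ℕ λ w → Occurs (l ++ ln) (entry (encode f) (pair x z) (suc w))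
    find z z<n+1 with z <? n
    ... | yes z<n = let (w′ , I′) = I z z<n in w′ , Occurs-++ˡ l ln I′
    ... | no z≮n with ≤-antisym (≤-pred z<n+1) (≮⇒≥ z≮n)
    ...   | refl = w , Occurs-++ʳ l ln In

  traced-mu : ∀ {f x y} → Traced f (pair x y) 0 → TracedBelow f x y → Traced (muC f) x y
  traced-mu {f} {x} {y} (traced l0 V0' I0) (lm , Vm , Im) =
      traced-step l P x y (ValidTrace-++ {oq} l0 lm V0' Vm)
        (by-mu (fst-pair 10 ef ,
          (Earlier-occurs l [ E ] Qa (Occurs-++ˡ l0 lm I0) (cong (λ q → pair q (pair (pair x y) 0)) (sym (snd-pair 10 ef))) ,
           λ z lt → let (wz , Iz) = Im z lt in
             Earlier-occurs l [ E ] (Qb z) (Occurs-++ʳ l0 lm Iz)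
               (trans (codeOf-entry ef (pair x z) (suc wz)) (sym (snd-pair 10 ef)) , inputOf-entry ef (pair x z) (suc wz) ,
                subst Truthy (sym (outputOf-entry ef (pair x z) (suc wz))) (s≤s z≤n)))))
      where
      ef = encode f
      P = muC f
      C = encode P
      l = l0 ++ lm
      E = entry C x y
      Qa : ℕ → Set
      Qa e1 = e1 ≡ pair (snd C) (pair (pair x y) 0)
      Qb : ℕ → ℕ → Set
      Qb z e1 = codeOf e1 ≡ snd C × (inputOf e1 ≡ pair x z × Truthy (outputOf e1))

  trace-complete : ∀ {p x v} → Eval Y p x v → Traced p x v
  trace-complete (e-zer x) = traced-step [] zer x 0 ValidTrace-[]
    (by-default (inj₁ (s≤s (s≤s z≤n)) , refl))
  trace-complete (e-suc x) = traced-step [] sucC x (suc x) ValidTrace-[] (by-suc (refl , refl))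
  trace-complete (e-id x) = traced-step [] idC x x ValidTrace-[] (by-id (refl , refl))
  trace-complete (e-fst x) = traced-step [] fstC x (fst x) ValidTrace-[] (by-fst (refl , refl))
  trace-complete (e-snd x) = traced-step [] sndC x (snd x) ValidTrace-[] (by-snd (refl , refl))
  trace-complete (e-orc x) = traced-step [] orcC x (if Y x then 1 else 0) ValidTrace-[] (by-oracle (refl , sym (hoq x)))
  trace-complete (e-comp d₁ d₂)   = traced-comp (trace-complete d₁) (trace-complete d₂)
  trace-complete (e-pair d₁ d₂)   = traced-pair (trace-complete d₁) (trace-complete d₂)
  trace-complete (e-rec0 {a = a} d)     = traced-rec0 {a = a} (trace-complete d)
  trace-complete (e-recS {a = a} d₁ d₂) = traced-recS {a = a} (trace-complete d₁) (trace-complete d₂)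
  trace-complete (e-mu {f} {x} {y} d h) =
    traced-mu (trace-complete d) (traced-below f x y λ z z<y → proj₁ (h z z<y) , trace-complete (proj₂ (h z z<y)))

  certificate-complete : ∀ {p x v} → Eval Y p x v → Σ ℕ λ K → Certificate oq (encode p) x v K
  certificate-complete ev with trace-complete ev
  ... | traced l V (j , lt , eq) =
    pair (length l) (encodeList l) ,
    subst₂ (ValidTrace oq) (sym (snd-pair (length l) (encodeList l))) (sym (fst-pair (length l) (encodeList l))) V ,
    j , subst (j <_) (sym (fst-pair (length l) (encodeList l))) lt ,
    trans (cong (λ L → nthN L j) (snd-pair (length l) (encodeList l))) eq

-- The join of two oracles

iter-suc : ∀ x k → iterN x (λ _ r → suc r) k ≡ k + x
iter-suc x zero = refl
iter-suc x (suc k) = cong suc (iter-suc x k)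

dbl-eq : ∀ x → dbl x ≡ x * 2
dbl-eq x = trans (iter-suc x x) (trans (cong (x +_) (sym (+-identityʳ x))) (*-comm 2 x))

⊕-even : ∀ A B x → (A ⊕ B) (dbl x) ≡ A x
⊕-even A B x = trans (cong (A ⊕ B) (dbl-eq x)) (cong₂ (λ a b → if a ≡ᵇ 0 then A b else B b) (m*n%n≡0 x 2) (m*n/n≡m x 2))

⊕-odd : ∀ A B x → (A ⊕ B) (suc (dbl x)) ≡ B x
⊕-odd A B x = trans (cong (λ n → (A ⊕ B) (suc n)) (dbl-eq x)) (cong₂ (λ a b → if a ≡ᵇ 0 then A b else B b) m1 d1)
  where
  m1 : (1 + x * 2) % 2 ≡ 1
  m1 = [m+kn]%n≡m%n 1 x 2
  d1 : (1 + x * 2) / 2 ≡ x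
  d1 = trans (+-distrib-/ 1 (x * 2) (subst (λ k → 1 % 2 + k < 2) (sym (m*n%n≡0 x 2)) (s≤s (s≤s z≤n))))
             (m*n/n≡m x 2)

joinˡ joinʳ : Code
joinˡ = compC orcC (compile₁ zer (addE v0 v0))
joinʳ = compC orcC (compile₁ zer (sucE (addE v0 v0)))

joinˡ-correct : ∀ A B → Computes (A ⊕ B) joinˡ A
joinˡ-correct A B n = subst (λ b → Eval (A ⊕ B) joinˡ n (if b then 1 else 0)) (⊕-even A B n)
  (e-comp (Compile₁.compile₁-correct (A ⊕ B) (λ _ → 0) zer e-zer (addE v0 v0) n) (e-orc _))

joinʳ-correct : ∀ A B → Computes (A ⊕ B) joinʳ B
joinʳ-correct A B n = subst (λ b → Eval (A ⊕ B) joinʳ n (if b then 1 else 0)) (⊕-odd A B n)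
  (e-comp (Compile₁.compile₁-correct (A ⊕ B) (λ _ → 0) zer e-zer (sucE (addE v0 v0)) n) (e-orc _))

FunIn⇒computable : ∀ {A₀ A₁ f} → FunIn A₀ A₁ f → Σ Code λ c → ∀ m → Eval (A₀ ⊕ A₁) c m (f m)
FunIn⇒computable {A₀} {A₁} {f} ((c , graph-from-A₀) , _) =
  fromGraphCode (plugOracle joinˡ c) ,
  fromGraphCode-correct f (λ n → plugOracle-correct (joinˡ-correct A₀ A₁) (graph-from-A₀ n))

-- A Σ⁰₃ definition of sparse conditions

module CertificateFormula (X : SubsetOfω) (f : ℕ → ℕ) where
  open Semantics X f
  open RenamingSemantics X f
  open DerivedSemantics X f
  open SubstitutionSemantics X f
  open JustifiedSemantics X f

  σ-justified : Fin 3 → Exp 6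
  σ-justified zero = var zero
  σ-justified (suc zero) = sndE (var (# 1))
  σ-justified (suc (suc zero)) = var (# 5)

  hitE₁ : Exp 6
  hitE₁ = eqE (nthE (sndE (var (# 1))) (var (# 0))) (pairE (var (# 4)) (pairE (var (# 3)) (var (# 2))))

  validE hitE certificateE : Exp 5
  validE = ballE (substE σ-justified justifiedE) (fstE v0)
  hitE = bexE hitE₁ (fstE v0)
  certificateE = andE validE hitE

  certificateE-Truthy : ∀ C v x c i → Truthy (⟦ certificateE ⟧ (C ∷ᵉ v ∷ᵉ x ∷ᵉ c ∷ᵉ i ∷ᵉ ρ∅)) ⇔ Certificate (oracleBit i) c x v C
  certificateE-Truthy C v x c i = ⇔-trans (andE-Truthy validE hitE ρc) (⇔-×
      (⇔-trans (ballE-Truthy (substE σ-justified justifiedE) (fstE v0) ρc) (⇔-∀< λ j →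
          ⇔-trans (Truthy-cong (substE-sem σ-justified justifiedE (j ∷ᵉ ρc) (j ∷ᵉ snd C ∷ᵉ i ∷ᵉ ρ∅)
                     (λ { zero → refl ; (suc zero) → refl ; (suc (suc zero)) → refl })))
            (justifiedE-Truthy j (snd C) i)))
      (⇔-trans (bexE-Truthy hitE₁ (fstE v0) ρc)
        (⇔-Σ< λ j → eqE-Truthy (nthE (sndE (var (# 1))) (var (# 0))) (pairE (var (# 4)) (pairE (var (# 3)) (var (# 2)))) (j ∷ᵉ ρc))))
    where
    ρc = C ∷ᵉ v ∷ᵉ x ∷ᵉ c ∷ᵉ i ∷ᵉ ρ∅

  σ-certificate : ∀ {n} → Exp n → Exp n → Exp n → Exp n → Exp n → Fin 5 → Exp n
  σ-certificate i c x v C zero = C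
  σ-certificate i c x v C (suc zero) = v
  σ-certificate i c x v C (suc (suc zero)) = x
  σ-certificate i c x v C (suc (suc (suc zero))) = c
  σ-certificate i c x v C (suc (suc (suc (suc zero)))) = i

  certificateAt : ∀ {n} → Exp n → Exp n → Exp n → Exp n → Exp n → Exp n
  certificateAt i c x v C = substE (σ-certificate i c x v C) certificateE

  certificateAt-Truthy : ∀ {n} (i c x v C : Exp n) ρ →
    Truthy (⟦ certificateAt i c x v C ⟧ ρ) ⇔ Certificate (oracleBit (⟦ i ⟧ ρ)) (⟦ c ⟧ ρ) (⟦ x ⟧ ρ) (⟦ v ⟧ ρ) (⟦ C ⟧ ρ)
  certificateAt-Truthy i c x v C ρ = ⇔-trans (Truthy-cong (substE-sem (σ-certificate i c x v C) certificateE ρ (⟦ C ⟧ ρ ∷ᵉ ⟦ v ⟧ ρ ∷ᵉ ⟦ x ⟧ ρ ∷ᵉ ⟦ c ⟧ ρ ∷ᵉ ⟦ i ⟧ ρ ∷ᵉ ρ∅)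
      (λ { zero → refl ; (suc zero) → refl ; (suc (suc zero)) → refl ; (suc (suc (suc zero))) → refl ; (suc (suc (suc (suc zero)))) → refl })))
    (certificateE-Truthy (⟦ C ⟧ ρ) (⟦ v ⟧ ρ) (⟦ x ⟧ ρ) (⟦ c ⟧ ρ) (⟦ i ⟧ ρ))

oracleBit-select : ∀ A₀ A₁ i x → JustifiedSemantics.oracleBit (A₀ ⊕ A₁) (λ _ → 0) i x ≡ (if select A₀ A₁ i x then 1 else 0)
oracleBit-select A₀ A₁ zero x = cong (λ b → if b then 1 else 0) (⊕-even A₀ A₁ x)
oracleBit-select A₀ A₁ (suc i) x = cong (λ b → if b then 1 else 0) (⊕-odd A₀ A₁ x)

module SparseFormula (X : SubsetOfω) (f : ℕ → ℕ) where
  open Semantics X f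
  open RenamingSemantics X f
  open DerivedSemantics X f
  open SubstitutionSemantics X f
  open JustifiedSemantics X f
  open CertificateFormula X f

  -- SparseCodes ⟨d , ⟨i , e⟩⟩ is ∃ e′ ∀ y₂ ∃ y₃ SparseMatrix d i e e′ y₂ y₃. The witness
  -- y₃ = ⟨v , K , K′ , j , Kⱼ⟩ gives the value v of S at y₂ with certificates K from A_i and K′ from
  -- the other oracle A_(isZero i), and an element j ≥ y₂ of S certified by Kⱼ.
  Total : ℕ → ℕ → ℕ → ℕ → ℕ × ℕ × ℕ × ℕ × ℕ → Set
  Total i e e′ x (v , K , K′ , _ , _) =
    v ≤ 1 × Certificate (oracleBit i) e x v K × Certificate (oracleBit (isZero i)) e′ x v K′

  Unbounded : ℕ → ℕ → ℕ → ℕ × ℕ × ℕ × ℕ × ℕ → Set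
  Unbounded i e m (_ , _ , _ , j , K) = m ≤ j × Certificate (oracleBit i) e j 1 K

  EarlyViolation : ℕ → ℕ → ℕ → ℕ × ℕ × ℕ → Set
  EarlyViolation d i e (y , x , K) = Certificate (oracleBit i) e y 1 K × (y < d ⊎ (x ≤ d × y < f x))

  GapViolation : ℕ → ℕ → ℕ × ℕ × ℕ × ℕ × ℕ → Set
  GapViolation i e (y′ , y , x , K′ , K) =
    Certificate (oracleBit i) e y′ 1 K′ × Certificate (oracleBit i) e y 1 K × y′ < y × x ≤ suc y′ × y < f x

  SparseMatrix : ℕ → ℕ → ℕ → ℕ → ℕ → ℕ → Set
  SparseMatrix d i e e′ y₂ y₃ =
    Total i e e′ y₂ (untuple₅ y₃) × Unbounded i e y₂ (untuple₅ y₃) ×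
    ¬ EarlyViolation d i e (untuple₃ y₂) × ¬ GapViolation i e (untuple₅ y₂)

  argE y₃E y₂E e′E tE dE iE eE : Exp 1
  argE = v0
  y₃E = sndE argE
  y₂E = sndE (fstE argE)
  e′E = sndE (fstE (fstE argE))
  tE = fstE (fstE (fstE argE))
  dE = fstE tE
  iE = fstE (sndE tE)
  eE = sndE (sndE tE)

  totalE₁ totalE₂ totalE₃ totalE : Exp 1
  totalE₁ = leE (fstE y₃E) (lit 1)
  totalE₂ = certificateAt iE eE y₂E (fstE y₃E) (fstE (sndE y₃E))
  totalE₃ = certificateAt (isz iE) e′E y₂E (fstE y₃E) (fstE (sndE (sndE y₃E)))
  totalE = andE totalE₁ (andE totalE₂ totalE₃)

  unboundedJ unboundedK unboundedE₁ unboundedE₂ unboundedE : Exp 1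
  unboundedJ = fstE (sndE (sndE (sndE y₃E)))
  unboundedK = sndE (sndE (sndE (sndE y₃E)))
  unboundedE₁ = leE y₂E unboundedJ
  unboundedE₂ = certificateAt iE eE unboundedJ (lit 1) unboundedK
  unboundedE = andE unboundedE₁ unboundedE₂

  earlyY earlyX earlyK earlyE₁ earlyE₂ earlyE₃ noEarlyE : Exp 1
  earlyY = fstE y₂E
  earlyX = fstE (sndE y₂E)
  earlyK = sndE (sndE y₂E)
  earlyE₁ = certificateAt iE eE earlyY (lit 1) earlyK
  earlyE₃ = andE (leE earlyX dE) (ltE earlyY (appF earlyX))
  earlyE₂ = orE (ltE earlyY dE) earlyE₃
  noEarlyE = isz (andE earlyE₁ earlyE₂)

  gapY′ gapY gapX gapK′ gapK gapE₁ gapE₂ gapE₃ gapE₄ gapE₅ noGapE : Exp 1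
  gapY′ = fstE y₂E
  gapY = fstE (sndE y₂E)
  gapX = fstE (sndE (sndE y₂E))
  gapK′ = fstE (sndE (sndE (sndE y₂E)))
  gapK = sndE (sndE (sndE (sndE y₂E)))
  gapE₁ = certificateAt iE eE gapY′ (lit 1) gapK′
  gapE₂ = certificateAt iE eE gapY (lit 1) gapK
  gapE₅ = andE (leE gapX (sucE gapY′)) (ltE gapY (appF gapX))
  gapE₄ = andE (ltE gapY′ gapY) gapE₅
  gapE₃ = andE gapE₂ gapE₄
  noGapE = isz (andE gapE₁ gapE₃)

  sparseMatrixE : Exp 1
  sparseMatrixE = andE totalE (andE unboundedE (andE noEarlyE noGapE))

  module _ (n : ℕ) where
    ρn : Env 1
    ρn = n ∷ᵉ ρ∅

    sparseMatrixE-Truthy : Truthy (⟦ sparseMatrixE ⟧ ρn) ⇔ SparseMatrix (⟦ dE ⟧ ρn) (⟦ iE ⟧ ρn) (⟦ eE ⟧ ρn) (⟦ e′E ⟧ ρn) (⟦ y₂E ⟧ ρn) (⟦ y₃E ⟧ ρn)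
    sparseMatrixE-Truthy = ⇔-trans (andE-Truthy totalE (andE unboundedE (andE noEarlyE noGapE)) ρn) (⇔-×
      (⇔-trans (andE-Truthy totalE₁ (andE totalE₂ totalE₃) ρn) (⇔-× (leE-Truthy (fstE y₃E) (lit 1) ρn)
         (⇔-trans (andE-Truthy totalE₂ totalE₃ ρn) (⇔-×
            (certificateAt-Truthy iE eE y₂E (fstE y₃E) (fstE (sndE y₃E)) ρn)
            (certificateAt-Truthy (isz iE) e′E y₂E (fstE y₃E) (fstE (sndE (sndE y₃E))) ρn)))))
      (⇔-trans (andE-Truthy unboundedE (andE noEarlyE noGapE) ρn) (⇔-×
         (⇔-trans (andE-Truthy unboundedE₁ unboundedE₂ ρn) (⇔-× (leE-Truthy y₂E unboundedJ ρn) (certificateAt-Truthy iE eE unboundedJ (lit 1) unboundedK ρn)))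
         (⇔-trans (andE-Truthy noEarlyE noGapE ρn) (⇔-×
            (⇔-trans (isz-Truthy-¬ (andE earlyE₁ earlyE₂) ρn) (⇔-¬ (⇔-trans (andE-Truthy earlyE₁ earlyE₂ ρn) (⇔-×
               (certificateAt-Truthy iE eE earlyY (lit 1) earlyK ρn)
               (⇔-trans (orE-Truthy (ltE earlyY dE) earlyE₃ ρn) (⇔-⊎ (ltE-Truthy earlyY dE ρn)
                  (⇔-trans (andE-Truthy (leE earlyX dE) (ltE earlyY (appF earlyX)) ρn) (⇔-× (leE-Truthy earlyX dE ρn) (ltE-Truthy earlyY (appF earlyX) ρn)))))))))
            (⇔-trans (isz-Truthy-¬ (andE gapE₁ gapE₃) ρn) (⇔-¬ (⇔-trans (andE-Truthy gapE₁ gapE₃ ρn) (⇔-×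
               (certificateAt-Truthy iE eE gapY′ (lit 1) gapK′ ρn)
               (⇔-trans (andE-Truthy gapE₂ gapE₄ ρn) (⇔-×
                  (certificateAt-Truthy iE eE gapY (lit 1) gapK ρn)
                  (⇔-trans (andE-Truthy (ltE gapY′ gapY) gapE₅ ρn) (⇔-× (ltE-Truthy gapY′ gapY ρn)
                     (⇔-trans (andE-Truthy (leE gapX (sucE gapY′)) (ltE gapY (appF gapX)) ρn) (⇔-× (leE-Truthy gapX (sucE gapY′) ρn) (ltE-Truthy gapY (appF gapX) ρn))))))))))))))))

  -- Opaque only so that the type checker never unfolds the (large) formula.
  opaque
    Q3 : ℕ → Set
    Q3 n = Truthy (⟦ sparseMatrixE ⟧ (n ∷ᵉ ρ∅))

  Q2 Q1 SparseCodes : ℕ → Set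
  Q2 w = Σ ℕ λ y → Q3 (pair w y)
  Q1 z = ∀ y → Q2 (pair z y)
  SparseCodes x = Σ ℕ λ y → Q1 (pair x y)

  SparseMatrix-cong : ∀ {a b c d e g a' b' c' d' e' g'} → a ≡ a' → b ≡ b' → c ≡ c' → d ≡ d' → e ≡ e' → g ≡ g' →
           SparseMatrix a b c d e g ⇔ SparseMatrix a' b' c' d' e' g'
  SparseMatrix-cong refl refl refl refl refl refl = ⇔-refl

  module CodeComponents (d i e e' y2' y3' : ℕ) where
    t = pair d (pair i e)
    n = pair (pair (pair t e') y2') y3'
    n1 : fst n ≡ pair (pair t e') y2'
    n1 = fst-pair (pair (pair t e') y2') y3'
    n2 : fst (fst n) ≡ pair t e'
    n2 = trans (cong fst n1) (fst-pair (pair t e') y2')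
    n3 : fst (fst (fst n)) ≡ t
    n3 = trans (cong fst n2) (fst-pair t e')
    ed : fst (fst (fst (fst n))) ≡ d
    ed = trans (cong fst n3) (fst-pair d _)
    st : snd (fst (fst (fst n))) ≡ pair i e
    st = trans (cong snd n3) (snd-pair d _)
    ei : fst (snd (fst (fst (fst n)))) ≡ i
    ei = trans (cong fst st) (fst-pair i e)
    ee : snd (snd (fst (fst (fst n)))) ≡ e
    ee = trans (cong snd st) (snd-pair i e)
    ee' : snd (fst (fst n)) ≡ e'
    ee' = trans (cong snd n2) (snd-pair t e')
    ey2 : snd (fst n) ≡ y2'
    ey2 = trans (cong snd n1) (snd-pair (pair t e') y2')
    ey3 : snd n ≡ y3'
    ey3 = snd-pair (pair (pair t e') y2') y3'

  opaque
    unfolding Q3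
    SparseCodes-matrix : ∀ d i e e' y2' y3' → Q3 (pair (pair (pair (pair d (pair i e)) e') y2') y3') ⇔ SparseMatrix d i e e' y2' y3'
    SparseCodes-matrix d i e e' y2' y3' = ⇔-trans (sparseMatrixE-Truthy (pair (pair (pair (pair d (pair i e)) e') y2') y3'))
      (SparseMatrix-cong (CodeComponents.ed d i e e' y2' y3') (CodeComponents.ei d i e e' y2' y3') (CodeComponents.ee d i e e' y2' y3')
              (CodeComponents.ee' d i e e' y2' y3') (CodeComponents.ey2 d i e e' y2' y3') (CodeComponents.ey3 d i e e' y2' y3'))

module SparseFormulaComputable (X : SubsetOfω) (f : ℕ → ℕ) (cf : Code) (hcf : ∀ m → Eval X cf m (f m)) where
  open Semantics X f
  open DerivedSemantics X f
  open Compile₁ X f cf hcf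
  open SparseFormula X f

  rcode : Code
  rcode = compile₁ cf (notZ sparseMatrixE)

  opaque
    unfolding Q3
    Q3-comp : ComputableIn X Q3
    Q3-comp = rcode , λ n → decide n (compile₁-correct (notZ sparseMatrixE) n)
      where
      decide : ∀ n → Eval X rcode n (⟦ notZ sparseMatrixE ⟧ (n ∷ᵉ ρ∅)) → (Eval X rcode n 0 × ¬ Q3 n) ⊎ (Eval X rcode n 1 × Q3 n)
      decide n ev = by-value (⟦ sparseMatrixE ⟧ (n ∷ᵉ ρ∅)) refl ev
        where
        by-value : ∀ v → v ≡ ⟦ sparseMatrixE ⟧ (n ∷ᵉ ρ∅) → Eval X rcode n (isZero (isZero v)) → (Eval X rcode n 0 × ¬ Q3 n) ⊎ (Eval X rcode n 1 × Q3 n)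
        by-value zero eq ev' = inj₁ (ev' , λ q → zero-not-Truthy (sym eq) q)
        by-value (suc m) eq ev' = inj₂ (ev' , subst Truthy eq (s≤s z≤n))

  SparseCodes-Σ⁰₃ : Σ⁰ 3 X SparseCodes
  SparseCodes-Σ⁰₃ = Q1 , (Q2 , (Q3 , Level.lift Q3-comp , λ x → (λ q → q) , (λ q → q)) , λ x → (λ q → q) , (λ q → q)) ,
         λ x → (λ q → q) , (λ q → q)

-- Sparse conditions force domination

record Sparse (f : ℕ → ℕ) (d : ℕ) (S : SubsetOfω) : Set where
  field
    beyond-d      : ∀ y → S y ≡ true → d ≤ y
    bounds-prefix : ∀ y x → S y ≡ true → x ≤ d → f x ≤ y
    bounds-gap    : ∀ y′ y x → S y′ ≡ true → S y ≡ true → y′ < y → x ≤ suc y′ → f x ≤ y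

bit⇒< : ∀ d k → bit d k ≡ true → k < d
bit⇒< zero    zero    ()
bit⇒< (suc d) zero    _  = s≤s z≤n
bit⇒< zero    (suc k) eq = contradiction (bit⇒< zero k eq) λ ()
bit⇒< (suc d) (suc k) eq = ≤-<-trans (bit⇒< (suc d / 2) k eq) (m/n<m (suc d) 2 (s≤s (s≤s z≤n)))

satisfies-beyond : ∀ {G d S y} → Satisfies G d S → G y ≡ true → d ≤ y → S y ≡ true
satisfies-beyond {d = d} {y = y} (_ , G⊆D∪S) y∈G d≤y with G⊆D∪S y y∈G
... | inj₁ y∈D = contradiction d≤y (<⇒≱ (bit⇒< d y y∈D))
... | inj₂ y∈S = y∈S

countBelow-≤ : ∀ (G : SubsetOfω) n → countBelow G n ≤ n
countBelow-≤ G zero = z≤n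
countBelow-≤ G (suc n) with G n
... | true  = s≤s (countBelow-≤ G n)
... | false = m≤n⇒m≤1+n (countBelow-≤ G n)

countBelow-gap : ∀ (G : SubsetOfω) a k → (∀ z → a ≤ z → z < a + k → G z ≡ false) →
                 countBelow G (a + k) ≡ countBelow G a
countBelow-gap G a zero    gap = cong (countBelow G) (+-identityʳ a)
countBelow-gap G a (suc k) gap rewrite +-suc a k with G (a + k) in a+k∈G
... | true  = contradiction (trans (sym a+k∈G) (gap (a + k) (m≤m+n a k) ≤-refl)) λ ()
... | false = countBelow-gap G a k (λ z a≤z z<a+k → gap z a≤z (m<n⇒m<1+n z<a+k))

countBelow-gap-≤ : ∀ (G : SubsetOfω) a m → a ≤ m → (∀ z → a ≤ z → z < m → G z ≡ false) →
                   countBelow G m ≤ a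
countBelow-gap-≤ G a m a≤m gap = begin
  countBelow G m             ≡⟨ cong (countBelow G) (sym (m+[n∸m]≡n a≤m)) ⟩
  countBelow G (a + (m ∸ a)) ≡⟨ countBelow-gap G a (m ∸ a) (λ z a≤z z< → gap z a≤z (subst (z <_) (m+[n∸m]≡n a≤m) z<)) ⟩
  countBelow G a             ≤⟨ countBelow-≤ G a ⟩
  a                          ∎
  where open ≤-Reasoning

last-in-range : ∀ (G : SubsetOfω) a m →
  (∀ z → a ≤ z → z < m → G z ≡ false) ⊎
  (Σ ℕ λ y → a ≤ y × y < m × G y ≡ true × (∀ z → y < z → z < m → G z ≡ false))
last-in-range G a zero = inj₁ (λ z _ ())
last-in-range G a (suc m) with a ≤? m | G m in m∈G
... | no a≰m | _ = inj₁ (λ z a≤z z≤m → contradiction (≤-trans a≤z (≤-pred z≤m)) a≰m)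
... | yes a≤m | true = inj₂ (m , a≤m , ≤-refl , m∈G , λ z m<z z≤m → contradiction (≤-pred z≤m) (<⇒≱ m<z))
... | yes a≤m | false with last-in-range G a m
...   | inj₁ gap = inj₁ (λ z a≤z z≤m → extend gap z a≤z z≤m)
  where
  extend : (∀ z → a ≤ z → z < m → G z ≡ false) → ∀ z → a ≤ z → z < suc m → G z ≡ false
  extend gap z a≤z z≤m with z ≟ m
  ... | yes refl = m∈G
  ... | no z≢m  = gap z a≤z (≤∧≢⇒< (≤-pred z≤m) z≢m)
...   | inj₂ (y , a≤y , y<m , y∈G , gap) = inj₂ (y , a≤y , m<n⇒m<1+n y<m , y∈G , extend)
  where
  extend : ∀ z → y < z → z < suc m → G z ≡ false
  extend z y<z z≤m with z ≟ m
  ... | yes refl = m∈G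
  ... | no z≢m  = gap z y<z (≤∧≢⇒< (≤-pred z≤m) z≢m)

sparse-dominates : ∀ {G S f d} → Satisfies G d S → Sparse f d S →
                   ∀ x → d ≤ x → ∀ m → PrincipalAt G x m → f x ≤ m
sparse-dominates {G} {S} {f} {d} sat sparse x d≤x m (m∈G , count≡x) =
  [ (λ gap → bounds-prefix m x m∈S (x≤ d d≤m gap))
  , (λ { (y , d≤y , y<m , y∈G , gap) →
           bounds-gap y m x (satisfies-beyond sat y∈G d≤y) m∈S y<m (x≤ (suc y) y<m gap) })
  ]′ (last-in-range G d m)
  where
  open Sparse sparse
  d≤m : d ≤ m
  d≤m = ≤-trans d≤x (subst (_≤ m) count≡x (countBelow-≤ G m))
  m∈S : S m ≡ true
  m∈S = satisfies-beyond sat m∈G d≤m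
  x≤ : ∀ a → a ≤ m → (∀ z → a ≤ z → z < m → G z ≡ false) → x ≤ a
  x≤ a a≤m gap = subst (_≤ a) count≡x (countBelow-gap-≤ G a m a≤m gap)

-- Thinning a condition to a sparse one

Truthy-if : ∀ b → Truthy (if b then 1 else 0) ⇔ b ≡ true
Truthy-if true = (λ _ → refl) , (λ _ → s≤s z≤n)
Truthy-if false = (λ ()) , (λ ())

sumBelow : (ℕ → ℕ) → ℕ → ℕ
sumBelow f zero = 0
sumBelow f (suc n) = f n + sumBelow f n

sumBelow-≥ : ∀ f n x → x < n → f x ≤ sumBelow f n
sumBelow-≥ f (suc n) x lt with x ≟ n
... | yes refl = m≤m+n (f x) _
... | no ne = ≤-trans (sumBelow-≥ f n x (≤∧≢⇒< (≤-pred lt) ne)) (m≤n+m _ (f n))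

module Thinning (S : SubsetOfω) (f : ℕ → ℕ) (d : ℕ) where
  O : SubsetOfω
  O = S ⊕ graph f

  open Semantics O f
  open RenamingSemantics O f
  open DerivedSemantics O f
  open SubstitutionSemantics O f

  inSE beyondE boundsPrefixE boundsLastE boundsE admissibleE : Exp 2
  inSE = orcE (addE v0 v0)
  beyondE = leE (lit d) v0
  boundsPrefixE = ballE (leE (appF v0) v1) (sucE (lit d))
  boundsLastE = orE (isz v1) (ballE (leE (appF v0) v1) (sucE v1))
  boundsE = andE boundsPrefixE boundsLastE
  admissibleE = andE inSE (andE beyondE boundsE)

  admissible : ℕ → ℕ → ℕ
  admissible y l = ⟦ admissibleE ⟧ (y ∷ᵉ l ∷ᵉ ρ∅)

  Admissible : ℕ → ℕ → Set
  Admissible y l = S y ≡ true × (d ≤ y × ((∀ x → x < suc d → f x ≤ y) × (l ≡ 0 ⊎ (∀ x → x < suc l → f x ≤ y))))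

  admissible-Truthy : ∀ y l → Truthy (admissible y l) ⇔ Admissible y l
  admissible-Truthy y l = ⇔-trans (andE-Truthy inSE (andE beyondE boundsE) ρ) (⇔-×
      (subst (λ b → Truthy (if b then 1 else 0) ⇔ (S y ≡ true)) (sym (⊕-even S (graph f) y)) (Truthy-if (S y)))
      (⇔-trans (andE-Truthy beyondE boundsE ρ) (⇔-× (leE-Truthy (lit d) v0 ρ)
        (⇔-trans (andE-Truthy boundsPrefixE boundsLastE ρ) (⇔-×
          (⇔-trans (ballE-Truthy (leE (appF v0) v1) (sucE (lit d)) ρ) (⇔-∀< λ x → leE-Truthy (appF v0) v1 (x ∷ᵉ ρ)))
          (⇔-trans (orE-Truthy (isz v1) (ballE (leE (appF v0) v1) (sucE v1)) ρ)
            (⇔-⊎ (isz-Truthy v1 ρ) (⇔-trans (ballE-Truthy (leE (appF v0) v1) (sucE v1) ρ) (⇔-∀< λ x → leE-Truthy (appF v0) v1 (x ∷ᵉ ρ))))))))))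
    where
    ρ = y ∷ᵉ l ∷ᵉ ρ∅

  -- One more than the last element of S′ below y, or 0 if there is none.
  afterLast : ℕ → ℕ
  afterLast zero = 0
  afterLast (suc y) = if admissible y (afterLast y) ≡ᵇ 0 then afterLast y else suc y

  afterLastE : Exp 1
  afterLastE = recE (lit 0) (ifE (ren inject₁ admissibleE) (sucE v0) v1) v0

  afterLastE-sem : ∀ y → ⟦ afterLastE ⟧ (y ∷ᵉ ρ∅) ≡ afterLast y
  afterLastE-sem y = trans (iterN-cong 0 step y) (unfold y)
    where
    g : ℕ → ℕ → ℕ
    g y' l = if admissible y' l ≡ᵇ 0 then l else suc y'
    step : ∀ y' l → ⟦ ifE (ren inject₁ admissibleE) (sucE v0) v1 ⟧ (y' ∷ᵉ l ∷ᵉ y ∷ᵉ ρ∅) ≡ g y' l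
    step y' l = trans (ifE-sem (ren inject₁ admissibleE) (sucE v0) v1 (y' ∷ᵉ l ∷ᵉ y ∷ᵉ ρ∅))
      (cong (λ c → if c ≡ᵇ 0 then l else suc y')
        (ren-sem inject₁ admissibleE (y' ∷ᵉ l ∷ᵉ y ∷ᵉ ρ∅) (y' ∷ᵉ l ∷ᵉ ρ∅) (λ { zero → refl ; (suc zero) → refl })))
    unfold : ∀ y → iterN 0 g y ≡ afterLast y
    unfold zero = refl
    unfold (suc y) = cong (g y) (unfold y)

  σ-afterLast : Fin 2 → Exp 1
  σ-afterLast zero = v0
  σ-afterLast (suc zero) = afterLastE

  thinnedE : Exp 1
  thinnedE = notZ (substE σ-afterLast admissibleE)

  S′ : SubsetOfω
  S′ y = not (admissible y (afterLast y) ≡ᵇ 0)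

  thinnedE-sem : ∀ y → ⟦ thinnedE ⟧ (y ∷ᵉ ρ∅) ≡ (if S′ y then 1 else 0)
  thinnedE-sem y = trans (cong (λ v → isZero (isZero v)) (substE-sem σ-afterLast admissibleE (y ∷ᵉ ρ∅) (y ∷ᵉ afterLast y ∷ᵉ ρ∅)
                 (λ { zero → refl ; (suc zero) → afterLastE-sem y }))) (lem (admissible y (afterLast y)))
    where
    lem : ∀ v → isZero (isZero v) ≡ (if not (v ≡ᵇ 0) then 1 else 0)
    lem zero = refl
    lem (suc v) = refl

  thinned-admissible : ∀ y → S′ y ≡ true → Admissible y (afterLast y)
  thinned-admissible y eq with admissible y (afterLast y) in cv
  ... | zero = contradiction eq λ ()
  ... | suc m = proj₁ (admissible-Truthy y (afterLast y)) (subst Truthy (sym cv) (s≤s z≤n))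

  admissible-thinned : ∀ y → Admissible y (afterLast y) → S′ y ≡ true
  admissible-thinned y cp with admissible y (afterLast y) in cv
  ... | zero = ⊥-elim (zero-not-Truthy cv (proj₂ (admissible-Truthy y (afterLast y)) cp))
  ... | suc m = refl

  afterLast-thinned : ∀ y → S′ y ≡ true → afterLast (suc y) ≡ suc y
  afterLast-thinned y eq with admissible y (afterLast y)
  ... | zero = contradiction eq λ ()
  ... | suc m = refl

  afterLast-skipped : ∀ y → S′ y ≡ false → afterLast (suc y) ≡ afterLast y
  afterLast-skipped y eq with admissible y (afterLast y)
  ... | zero = refl
  ... | suc m = contradiction eq λ ()

  afterLast-≤ : ∀ y → afterLast y ≤ y
  afterLast-≤ zero = z≤n
  afterLast-≤ (suc y) with admissible y (afterLast y) ≡ᵇ 0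
  ... | true = m≤n⇒m≤1+n (afterLast-≤ y)
  ... | false = ≤-refl

  afterLast-suc-mono : ∀ y → afterLast y ≤ afterLast (suc y)
  afterLast-suc-mono y with admissible y (afterLast y) ≡ᵇ 0
  ... | true = ≤-refl
  ... | false = m≤n⇒m≤1+n (afterLast-≤ y)

  afterLast-mono : ∀ y k → afterLast y ≤ afterLast (k + y)
  afterLast-mono y zero = ≤-refl
  afterLast-mono y (suc k) = ≤-trans (afterLast-mono y k) (afterLast-suc-mono (k + y))

  thin-⊆ : ∀ y → S′ y ≡ true → S y ≡ true
  thin-⊆ y eq = proj₁ (thinned-admissible y eq)

  afterLast-beyond : ∀ y′ y → S′ y′ ≡ true → y′ < y → suc y′ ≤ afterLast y
  afterLast-beyond y′ y y′∈S′ y′<y = begin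
    suc y′                      ≡⟨ sym (afterLast-thinned y′ y′∈S′) ⟩
    afterLast (suc y′)              ≤⟨ afterLast-mono (suc y′) (y ∸ suc y′) ⟩
    afterLast (y ∸ suc y′ + suc y′) ≡⟨ cong afterLast (m∸n+n≡m y′<y) ⟩
    afterLast y                     ∎
    where open ≤-Reasoning

  thin-sparse : Sparse f d S′
  thin-sparse = record
    { beyond-d      = λ y eq → proj₁ (proj₂ (thinned-admissible y eq))
    ; bounds-prefix = λ y x eq x≤d → proj₁ (proj₂ (proj₂ (thinned-admissible y eq))) x (s≤s x≤d)
    ; bounds-gap    = gap
    }
    where
    gap : ∀ y′ y x → S′ y′ ≡ true → S′ y ≡ true → y′ < y → x ≤ suc y′ → f x ≤ y
    gap y′ y x y′∈S′ y∈S′ y′<y x≤y′+1 with proj₂ (proj₂ (proj₂ (thinned-admissible y y∈S′)))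
    ... | inj₁ lastA≡0 = contradiction (subst (suc y′ ≤_) lastA≡0 (afterLast-beyond y′ y y′∈S′ y′<y)) λ ()
    ... | inj₂ bounds  = bounds x (s≤s (≤-trans x≤y′+1 (afterLast-beyond y′ y y′∈S′ y′<y)))

  thinned-or-stable : ∀ m k → (Σ ℕ λ z → m ≤ z × S′ z ≡ true) ⊎ afterLast (k + m) ≡ afterLast m
  thinned-or-stable m zero = inj₂ refl
  thinned-or-stable m (suc k) with thinned-or-stable m k
  ... | inj₁ r = inj₁ r
  ... | inj₂ eq with S′ (k + m) in s
  ...   | true = inj₁ (k + m , m≤n+m m k , s)
  ...   | false = inj₂ (trans (afterLast-skipped (k + m) s) eq)

  -- If S′ has no element in [m , y) then afterLast y = afterLast m, so an element y ∈ S exceeding m, d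
  -- and all values of f up to max d (afterLast m) is admitted.
  thin-infinite′ : Infinite S → Infinite S′
  thin-infinite′ inf m with inf (m + d + sumBelow f (suc d) + sumBelow f (suc (afterLast m)))
  ... | (y , ge , sy) with thinned-or-stable m (y ∸ m)
  ...   | inj₁ (z , mz , s) = z , mz , s
  ...   | inj₂ eq = y , my , admissible-thinned y (sy , dy , (λ x lt → ≤-trans (sumBelow-≥ f (suc d) x lt) b2) ,
                       inj₂ (λ x lt → ≤-trans (sumBelow-≥ f (suc L) x (subst (λ q → x < suc q) eqL lt)) b3))
    where
    L = afterLast m
    my : m ≤ y
    my = ≤-trans (≤-trans (≤-trans (m≤m+n m d) (m≤m+n _ _)) (m≤m+n _ _)) ge
    dy : d ≤ y
    dy = ≤-trans (≤-trans (≤-trans (m≤n+m d m) (m≤m+n _ _)) (m≤m+n _ _)) ge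
    b2 : sumBelow f (suc d) ≤ y
    b2 = ≤-trans (≤-trans (m≤n+m _ (m + d)) (m≤m+n _ _)) ge
    b3 : sumBelow f (suc L) ≤ y
    b3 = ≤-trans (m≤n+m (sumBelow f (suc L)) (m + d + sumBelow f (suc d))) ge
    eqL : afterLast y ≡ L
    eqL = trans (cong afterLast (sym (m∸n+n≡m my))) eq

  opaque
    thin-infinite : Infinite S → Infinite S′
    thin-infinite = thin-infinite′

  opaque
    thinCode : Code
    thinCode = compile₁ (fromGraphCode joinʳ) thinnedE

    thin-correct : Computes O thinCode S′
    thin-correct y = subst (Eval O thinCode y) (thinnedE-sem y)
      (Compile₁.compile₁-correct O f (fromGraphCode joinʳ) (fromGraphCode-correct f (joinʳ-correct S (graph f))) thinnedE y)

-- The collection of sparse conditions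

if-1⇒true : ∀ b → (if b then 1 else 0) ≡ 1 → b ≡ true
if-1⇒true true  _ = refl
if-1⇒true false ()

if-≤1 : ∀ b → (if b then 1 else 0) ≤ 1
if-≤1 true  = s≤s z≤n
if-≤1 false = z≤n

opaque
  encodeᵒ : Code → ℕ
  encodeᵒ = encode

  decode-encodeᵒ : ∀ c → decode (encodeᵒ c) ≡ c
  decode-encodeᵒ = decode-encode

  encodeᵒ-eq : ∀ c → encodeᵒ c ≡ encode c
  encodeᵒ-eq c = refl

module SparseConditions (A₀ A₁ : SubsetOfω) (f : ℕ → ℕ) where
  open JustifiedSemantics (A₀ ⊕ A₁) f using (oracleBit)
  open SparseFormula (A₀ ⊕ A₁) f

  SparseCollection : Collection
  SparseCollection d S = Σ ℕ λ i → Σ ℕ λ e → SparseCodes (pair d (pair i e)) × Computes (select A₀ A₁ i) (decode e) S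

  opaque
    certified-eval : ∀ i e x v K → Certificate (oracleBit i) e x v K → Eval (select A₀ A₁ i) (decode e) x v
    certified-eval i e x v K = CertificateSoundness.certificate-sound (select A₀ A₁ i) (oracleBit i) (oracleBit-select A₀ A₁ i) {e} {x} {v} {K}

    certificate-of : ∀ i p {x v} → Eval (select A₀ A₁ i) p x v → Σ ℕ λ K → Certificate (oracleBit i) (encodeᵒ p) x v K
    certificate-of i p {x} {v} ev =
      subst (λ c → Σ ℕ λ K → Certificate (oracleBit i) c x v K) (sym (encodeᵒ-eq p))
        (CertificateCompleteness.certificate-complete (select A₀ A₁ i) (oracleBit i) (oracleBit-select A₀ A₁ i) ev)

  module Member {d i e : ℕ} {S : SubsetOfω} (S-computed : Computes (select A₀ A₁ i) (decode e) S)
                (codes : SparseCodes (pair d (pair i e))) where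
    e′ : ℕ
    e′ = proj₁ codes

    matrix : ∀ y₂ → Σ ℕ λ y₃ → SparseMatrix d i e e′ y₂ y₃
    matrix y₂ = let (y₃ , q) = proj₂ codes y₂ in y₃ , proj₁ (SparseCodes-matrix d i e e′ y₂ y₃) q

    certified-value : ∀ x v K → Certificate (oracleBit i) e x v K → v ≡ (if S x then 1 else 0)
    certified-value x v K c = Eval-functional (certified-eval i e x v K c) (S-computed x)

    certified-member : ∀ x K → Certificate (oracleBit i) e x 1 K → S x ≡ true
    certified-member x K c = if-1⇒true (S x) (sym (certified-value x 1 K c))

    member-certified : ∀ y → S y ≡ true → Σ ℕ λ K → Certificate (oracleBit i) e y 1 K
    member-certified y y∈S with matrix y
    ... | (y₃ , (_ , c , _) , _) =
      fst (snd y₃) ,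
      subst (λ v → Certificate (oracleBit i) e y v (fst (snd y₃)))
            (trans (certified-value y (fst y₃) (fst (snd y₃)) c) (cong (λ b → if b then 1 else 0) y∈S)) c

    S-computed′ : Computes (select A₀ A₁ (isZero i)) (decode e′) S
    S-computed′ x with matrix x
    ... | (y₃ , (_ , c , c′) , _) = subst (Eval _ (decode e′) x) (certified-value x (fst y₃) (fst (snd y₃)) c)
                                      (certified-eval (isZero i) e′ x (fst y₃) (fst (snd (snd y₃))) c′)

    S-infinite : Infinite S
    S-infinite m with matrix m
    ... | (y₃ , _ , (m≤j , c) , _) = fst (snd (snd (snd y₃))) , m≤j , certified-member (fst (snd (snd (snd y₃)))) (snd (snd (snd (snd y₃)))) c

    no-early : ∀ y x K → ¬ EarlyViolation d i e (y , x , K)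
    no-early y x K = subst (λ t → ¬ EarlyViolation d i e t) (untuple₃-tuple₃ (y , x , K))
      (proj₁ (proj₂ (proj₂ (proj₂ (matrix (tuple₃ (y , x , K)))))))

    no-gap : ∀ y′ y x K′ K → ¬ GapViolation i e (y′ , y , x , K′ , K)
    no-gap y′ y x K′ K = subst (λ t → ¬ GapViolation i e t) (untuple₅-tuple₅ (y′ , y , x , K′ , K))
      (proj₂ (proj₂ (proj₂ (proj₂ (matrix (tuple₅ (y′ , y , x , K′ , K)))))))

    sparse : Sparse f d S
    sparse = record
      { beyond-d      = λ y y∈S → let (K , c) = member-certified y y∈S in
                          ≮⇒≥ (λ y<d → no-early y 0 K (c , inj₁ y<d))
      ; bounds-prefix = λ y x y∈S x≤d → let (K , c) = member-certified y y∈S in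
                          ≮⇒≥ (λ y<fx → no-early y x K (c , inj₂ (x≤d , y<fx)))
      ; bounds-gap    = λ y′ y x y′∈S y∈S y′<y x≤y′+1 →
                          let (K′ , c′) = member-certified y′ y′∈S ; (K , c) = member-certified y y∈S in
                          ≮⇒≥ (λ y<fx → no-gap y′ y x K′ K (c′ , c , y′<y , x≤y′+1 , y<fx))
      }

    condition : ICondition A₀ A₁ d S
    condition = (S-infinite , λ k j k∈D j∈S → <-≤-trans (bit⇒< d k k∈D) (Sparse.beyond-d sparse j j∈S)) , in-ideal i S-computed S-computed′
      where
      in-ideal : ∀ i′ → Computes (select A₀ A₁ i′) (decode e) S → Computes (select A₀ A₁ (isZero i′)) (decode e′) S → Ideal A₀ A₁ S
      in-ideal zero    from-A₀ from-A₁ = (decode e , from-A₀) , (decode e′ , from-A₁)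
      in-ideal (suc _) from-A₁ from-A₀ = (decode e′ , from-A₀) , (decode e , from-A₁)

  SparseCollection-Σ⁰₃ : FunIn A₀ A₁ f → Σ-ICollection 3 A₀ A₁ SparseCollection
  SparseCollection-Σ⁰₃ fI =
    (λ { d S (i , e , codes , S-computed) → Member.condition S-computed codes }) ,
    SparseCodes , SparseCodes-Σ⁰₃ , λ d S → (λ c → c) , (λ c → c)
    where open SparseFormulaComputable (A₀ ⊕ A₁) f (proj₁ (FunIn⇒computable fI)) (proj₂ (FunIn⇒computable fI))

  module Thinned (isI : IsIdealPair A₀ A₁) (fI : FunIn A₀ A₁ f) {d : ℕ} {S : SubsetOfω} (S-inf : Infinite S) (S∈I : Ideal A₀ A₁ S) where
    open Thinning S f d public

    S⊕f∈I : Ideal A₀ A₁ O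
    S⊕f∈I = isI S (graph f) S∈I fI

    codeˡ codeʳ : Code
    codeˡ = plugOracle (proj₁ (proj₁ S⊕f∈I)) thinCode
    codeʳ = plugOracle (proj₁ (proj₂ S⊕f∈I)) thinCode

    codeˡ-correct : Computes A₀ codeˡ S′
    codeˡ-correct y = plugOracle-correct (proj₂ (proj₁ S⊕f∈I)) (thin-correct y)

    codeʳ-correct : Computes A₁ codeʳ S′
    codeʳ-correct y = plugOracle-correct (proj₂ (proj₂ S⊕f∈I)) (thin-correct y)

    e e′ : ℕ
    e  = encodeᵒ codeˡ
    e′ = encodeᵒ codeʳ

    S′-computed : Computes A₀ (decode e) S′
    S′-computed = subst (λ p → Computes A₀ p S′) (sym (decode-encodeᵒ codeˡ)) codeˡ-correct

    certified-member : ∀ x K → Certificate (oracleBit 0) e x 1 K → S′ x ≡ true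
    certified-member x K c = if-1⇒true (S′ x) (sym (Eval-functional (certified-eval 0 e x 1 K c) (S′-computed x)))

    witness : ℕ → ℕ × ℕ × ℕ × ℕ × ℕ
    witness y = (if S′ y then 1 else 0) ,
                proj₁ (certificate-of 0 codeˡ (codeˡ-correct y)) ,
                proj₁ (certificate-of 1 codeʳ (codeʳ-correct y)) ,
                j , proj₁ (certificate-of 0 codeˡ (codeˡ-correct j))
      where j = proj₁ (thin-infinite S-inf y)

    total : ∀ y → Total 0 e e′ y (witness y)
    total y = if-≤1 (S′ y) , proj₂ (certificate-of 0 codeˡ (codeˡ-correct y)) , proj₂ (certificate-of 1 codeʳ (codeʳ-correct y))

    unbounded : ∀ y → Unbounded 0 e y (witness y)
    unbounded y with thin-infinite S-inf y
    ... | (j , y≤j , j∈S′) =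
      y≤j , subst (λ v → Certificate (oracleBit 0) e j v (proj₁ (certificate-of 0 codeˡ (codeˡ-correct j))))
                  (cong (λ b → if b then 1 else 0) j∈S′) (proj₂ (certificate-of 0 codeˡ (codeˡ-correct j)))

    open Sparse thin-sparse

    no-early : ∀ t → ¬ EarlyViolation d 0 e t
    no-early (y , x , K) (c , inj₁ y<d) = <⇒≱ y<d (beyond-d y (certified-member y K c))
    no-early (y , x , K) (c , inj₂ (x≤d , y<fx)) = <⇒≱ y<fx (bounds-prefix y x (certified-member y K c) x≤d)

    no-gap : ∀ t → ¬ GapViolation 0 e t
    no-gap (y′ , y , x , K′ , K) (c′ , c , y′<y , x≤y′+1 , y<fx) =
      <⇒≱ y<fx (bounds-gap y′ y x (certified-member y′ K′ c′) (certified-member y K c) y′<y x≤y′+1)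

    matrix : ∀ y₂ → SparseMatrix d 0 e e′ y₂ (tuple₅ (witness y₂))
    matrix y₂ =
      subst (Total 0 e e′ y₂) (sym (untuple₅-tuple₅ (witness y₂))) (total y₂) ,
      subst (Unbounded 0 e y₂) (sym (untuple₅-tuple₅ (witness y₂))) (unbounded y₂) ,
      no-early (untuple₃ y₂) , no-gap (untuple₅ y₂)

    member : SparseCollection d S′
    member = 0 , e , (e′ , λ y₂ → tuple₅ (witness y₂) , proj₂ (SparseCodes-matrix d 0 e e′ y₂ _) (matrix y₂)) , S′-computed

    extends : Extends d S′ d S
    extends = (λ k k∈D → k∈D) , (λ k k∈D → inj₁ k∈D) , thin-⊆

  SparseCollection-unavoidable : IsIdealPair A₀ A₁ → FunIn A₀ A₁ f → ∀ G → ¬ Avoids A₀ A₁ G SparseCollection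
  SparseCollection-unavoidable isI fI G (d , S , ((S-inf , _) , S∈I) , _ , no-extension) =
    no-extension d S′ extends member
    where open Thinned isI fI S-inf S∈I

proposition3p1 : (A₀ A₁ : SubsetOfω) → IsIdealPair A₀ A₁ →
    (G : SubsetOfω) → Generic 3 A₀ A₁ G →
    (f : ℕ → ℕ) → FunIn A₀ A₁ f →
    Σ ℕ λ N → ∀ x → N ≤ x → ∀ m → PrincipalAt G x m → f x ≤ m
proposition3p1 A₀ A₁ isI G generic f fI =
  [ (λ { (d , S , (_ , _ , codes , S-computed) , G-satisfies) →
           d , sparse-dominates G-satisfies (Member.sparse S-computed codes) })
  , (λ avoids → ⊥-elim (SparseCollection-unavoidable isI fI G avoids))
  ]′ (generic SparseCollection (SparseCollection-Σ⁰₃ fI))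
  where open SparseConditions A₀ A₁ f
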